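{- Let $G$ be a $2$-connected graph of order $n$ with minimum degree $\delta$ and clique number $\omega$. If $\delta+\omega\ge n$, then $G$ is hamiltonian, unless $\frac{n+1}{2}\le\omega\le n-2$ and $G\cong K_{n-\omega}\vee (K_{2\omega-n}\cup \overline{K_{n-\omega}})$.
   Context: All graphs are finite, undirected, without loops or multiple edges. The clique number of $G$ is the maximum cardinality of a clique in $G$. A graph is hamiltonian if it has a cycle containing all its vertices. $K_m$ denotes the complete graph on $m$ vertices and $\overline{K_m}$ the edgeless graph on $m$ vertices. For graphs $G,H$, $G\cup H$ is their disjoint union and $G\vee H$ (the join) is obtained from $G\cup H$ by adding all edges between $V(G)$ and $V(H)$. -}

module Defs where

open import Data.Bool using (Bool; true; false)
open import Data.Nat using (ℕ; _≤_; _+_; _*_; _∸_)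
open import Data.Fin using (Fin; splitAt)
open import Data.Fin.Subset using (Subset; ∣_∣; _∈_)
open import Data.Vec using (tabulate)
open import Data.Sum using (_⊎_; inj₁; inj₂)
open import Data.Product using (Σ; ∃; ∃-syntax; _×_; _,_)
open import Data.Unit using (⊤)
open import Data.List using (List; _∷_; length; _∷ʳ_)
open import Data.List.Relation.Unary.Linked using (Linked)
open import Data.List.Relation.Unary.Unique.Propositional using (Unique)
import Data.List.Membership.Propositional as LM
open import Function.Bundles using (_↔_; Inverse)
open import Relation.Binary.PropositionalEquality using (_≡_; _≢_; refl)

record Graph (n : ℕ) : Set where
  field
    adj    : Fin n → Fin n → Bool
    sym    : ∀ u v → adj u v ≡ adj v u
    irrefl : ∀ v → adj v v ≡ false
open Graph public

module _ {n : ℕ} (G : Graph n) where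

  Adj : Fin n → Fin n → Set
  Adj u v = adj G u v ≡ true

  degree : Fin n → ℕ
  degree v = ∣ tabulate (adj G v) ∣

  IsMinDegree : ℕ → Set
  IsMinDegree δ = (∀ v → δ ≤ degree v) × (∃[ v ] degree v ≡ δ)

  IsClique : Subset n → Set
  IsClique S = ∀ u v → u ∈ S → v ∈ S → u ≢ v → Adj u v

  IsCliqueNumber : ℕ → Set
  IsCliqueNumber ω =
    (∃[ S ] (IsClique S × ∣ S ∣ ≡ ω)) × (∀ S → IsClique S → ∣ S ∣ ≤ ω)

  data Walk (ok : Fin n → Set) : Fin n → Fin n → Set where
    here : ∀ {u} → ok u → Walk ok u u
    step : ∀ {u w v} → ok u → Adj u w → Walk ok w v → Walk ok u v

  ConnectedOn : (Fin n → Set) → Set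
  ConnectedOn ok = ∀ u v → ok u → ok v → Walk ok u v

  TwoConnected : Set
  TwoConnected = (3 ≤ n) × ConnectedOn (λ _ → ⊤) × (∀ x → ConnectedOn (λ u → u ≢ x))

  Hamiltonian : Set
  Hamiltonian =
    Σ (Fin n) λ v₀ → Σ (List (Fin n)) λ rest →
      Unique (v₀ ∷ rest) × (∀ v → v LM.∈ (v₀ ∷ rest)) × (3 ≤ length (v₀ ∷ rest))
      × Linked Adj ((v₀ ∷ rest) ∷ʳ v₀)

_≅_ : ∀ {m k} → Graph m → Graph k → Set
_≅_ {m} {k} G H =
  Σ (Fin m ↔ Fin k) λ f → ∀ u v → adj G u v ≡ adj H (Inverse.to f u) (Inverse.to f v)

complete : (m : ℕ) → Graph m
complete m = record { adj = λ u v → notEq u v ; sym = symEq ; irrefl = irrEq }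
  where
  open import Data.Fin using (_≟_)
  open import Relation.Nullary using (yes; no)
  open import Relation.Binary.PropositionalEquality using () renaming (sym to ≡sym)
  notEq : Fin m → Fin m → Bool
  notEq u v with u ≟ v
  ... | yes _ = false
  ... | no  _ = true
  symEq : ∀ u v → notEq u v ≡ notEq v u
  symEq u v with u ≟ v | v ≟ u
  ... | yes _ | yes _ = refl
  ... | no  _ | no  _ = refl
  ... | yes p | no ¬q = Data.Empty.⊥-elim (¬q (≡sym p)) where import Data.Empty
  ... | no ¬p | yes q = Data.Empty.⊥-elim (¬p (≡sym q)) where import Data.Empty
  irrEq : ∀ v → notEq v v ≡ false
  irrEq v with v ≟ v
  ... | yes _ = refl
  ... | no ¬p = Data.Empty.⊥-elim (¬p refl) where import Data.Empty

edgeless : (m : ℕ) → Graph m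
edgeless m = record { adj = λ _ _ → false ; sym = λ _ _ → refl ; irrefl = λ _ → refl }

sumAdj : ∀ {a b} → Bool → Graph a → Graph b → Fin a ⊎ Fin b → Fin a ⊎ Fin b → Bool
sumAdj c G H (inj₁ u) (inj₁ v) = adj G u v
sumAdj c G H (inj₂ u) (inj₂ v) = adj H u v
sumAdj c G H (inj₁ u) (inj₂ v) = c
sumAdj c G H (inj₂ u) (inj₁ v) = c

sumAdj-sym : ∀ {a b} c (G : Graph a) (H : Graph b) x y → sumAdj c G H x y ≡ sumAdj c G H y x
sumAdj-sym c G H (inj₁ u) (inj₁ v) = sym G u v
sumAdj-sym c G H (inj₂ u) (inj₂ v) = sym H u v
sumAdj-sym c G H (inj₁ u) (inj₂ v) = refl
sumAdj-sym c G H (inj₂ u) (inj₁ v) = refl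

sumAdj-irr : ∀ {a b} c (G : Graph a) (H : Graph b) x → sumAdj c G H x x ≡ false
sumAdj-irr c G H (inj₁ u) = irrefl G u
sumAdj-irr c G H (inj₂ u) = irrefl H u

sumGraph : ∀ {a b} → Bool → Graph a → Graph b → Graph (a + b)
sumGraph {a} c G H = record
  { adj = λ u v → sumAdj c G H (splitAt a u) (splitAt a v)
  ; sym = λ u v → sumAdj-sym c G H (splitAt a u) (splitAt a v)
  ; irrefl = λ u → sumAdj-irr c G H (splitAt a u) }

-- disjoint union G ∪ H and join G ∨ H (vertices of G first, then H)
_∪ᴳ_ : ∀ {a b} → Graph a → Graph b → Graph (a + b)
G ∪ᴳ H = sumGraph false G H

_∨ᴳ_ : ∀ {a b} → Graph a → Graph b → Graph (a + b)
G ∨ᴳ H = sumGraph true G H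

exceptional : (n ω : ℕ) → Graph ((n ∸ ω) + ((2 * ω ∸ n) + (n ∸ ω)))
exceptional n ω = complete (n ∸ ω) ∨ᴳ (complete (2 * ω ∸ n) ∪ᴳ edgeless (n ∸ ω))

{-# OPTIONS --safe #-}
module Submission where

-- Fix a clique C of size ω and let R be the other r = n − ω ≤ δ vertices. Split C into the
-- vertices A with a neighbour in R and the rest B. Joining every vertex of A to every vertex
-- of R only joins pairs of degree sum at least ω + δ ≥ n, so by the Bondy–Chvátal closure
-- lemma it suffices to find a Hamiltonian cycle in this closure K. If R is empty G is
-- complete, and if B is empty K satisfies Ore's condition. Otherwise 2-connectivity yields two
-- vertices a₀ ≠ a₁ of A, and a cycle of K through all vertices outside B ∪ {a₀}, obtained from
-- Ore's theorem relative to that set, is opened at a₁ to splice in a path a₁ B a₀ through the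
-- clique. The relative Ore condition holds when |A| ≠ r. When |A| = r and R spans an edge
-- u₁u₂, drop u₂ and the edges inside R, apply the same argument and reinsert u₂ after u₁.
-- When |A| = r and R is independent, each vertex of R is adjacent to exactly A, and G is
-- K_{n−ω} ∨ (K_{2ω−n} ∪ \overline{K_{n−ω}}).

open import Defs
  using (Graph; adj; irrefl; TwoConnected; IsMinDegree; IsCliqueNumber; Hamiltonian; Walk; here; step;
         _≅_; exceptional; complete; edgeless; sumAdj; sumGraph; _∪ᴳ_)
open import Data.Bool using (Bool; true; false; _∧_; _∨_; not)
open import Data.Bool.Properties
  using (∧-comm; ∨-comm; ∧-zeroʳ; ∨-zeroʳ; ∧-identityʳ; ¬-not; not-¬; not-injective; T-≡; T?)
  renaming (_≟_ to _≟ᵇ_)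
open import Data.Empty using (⊥-elim)
open import Data.Fin using (Fin; zero; suc; join)
open import Data.Fin.Properties using (_≟_; any?; splitAt-join; +↔⊎)
open import Data.Fin.Subset using (Subset; ∣_∣)
open import Data.List using (List; []; _∷_; _++_; length; reverse; _ʳ++_; _∷ʳ_; [_]; lookup; filterᵇ; allFin)
open import Data.List.Properties using (length-reverse)
open import Data.List.Membership.Propositional using (_∈_; _∉_)
open import Data.List.Membership.Propositional.Properties
  using (∈-filter⁺; ∈-filter⁻; ∈-allFin; ∈-lookup; ∈-++⁺ˡ; ∈-++⁺ʳ; ∈-++⁻)
open import Data.List.Membership.Propositional.Properties.WithK using (unique⇒irrelevant)
import Data.List.Membership.DecPropositional as DecMembership
import Data.List.Relation.Unary.All as All
open All using ([])
open import Data.List.Relation.Unary.All.Properties using (¬Any⇒All¬)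
import Data.List.Relation.Unary.AllPairs as AllPairs
open AllPairs using ([]; _∷_)
open import Data.List.Relation.Unary.Any as Any using (here; there)
open import Data.List.Relation.Unary.Any.Properties using (¬Any[]; reverse⁻; lookup-index)
open import Data.List.Relation.Unary.Linked using (Linked; [-]; _∷_)
open import Data.List.Relation.Unary.Unique.Propositional using (Unique)
open import Data.List.Relation.Unary.Unique.Propositional.Properties
  using (Unique[x∷xs]⇒x∉xs; ++⁺; filter⁺; allFin⁺)
open import Data.List.Relation.Binary.Disjoint.Propositional using (Disjoint)
open import Data.List.Relation.Binary.Permutation.Propositional using (_↭_; ↭-refl; ↭-sym; ↭-trans; ↭⇒↭ₛ)
open import Data.List.Relation.Binary.Permutation.Propositional.Properties
  using (∈-resp-↭; ↭-reverse; ↭-length; ++⁺ˡ; ++-comm)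
import Data.List.Relation.Binary.Permutation.Setoid.Properties as Setoid↭
open import Data.Nat using (ℕ; zero; suc; _+_; _*_; _∸_; _≤_; _<_; z≤n; s≤s) renaming (_≟_ to _≟ℕ_)
open import Data.Nat.Properties hiding (_≟_; ≡-irrelevant)
open import Data.Nat.Tactic.RingSolver using (solve-∀)
open import Data.Product using (Σ; ∃; ∃₂; _×_; _,_; proj₁; proj₂)
open import Data.Sum using (_⊎_; inj₁; inj₂; map₂)
open import Data.Sum.Function.Propositional using (_⊎-↔_)
open import Data.Unit using (⊤; tt)
open import Data.Vec as Vec using (tabulate)
open import Data.Vec.Properties using (lookup⇒[]=; tabulate∘lookup)
open import Function using (_∘_)
open import Function.Bundles using (Equivalence; _↔_; mk↔ₛ′)
open import Function.Construct.Composition using (_↔-∘_)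
open import Function.Construct.Identity using (↔-id)
open import Function.Properties.Inverse using (↔-sym)
open import Relation.Binary.Definitions using (tri<; tri≈; tri>)
open import Relation.Binary.PropositionalEquality
  using (_≡_; _≢_; refl; sym; trans; cong; cong₂; subst; module ≡-Reasoning)
open import Relation.Binary.PropositionalEquality.Properties using (setoid)
open import Relation.Binary.PropositionalEquality.WithK using (≡-irrelevant)
open import Relation.Nullary using (¬_; Dec; yes; no; ¬?; _×-dec_)
open import Relation.Nullary.Decidable using (does; ⌊_⌋; toWitness; fromWitness; decidable-stable)
open import Relation.Nullary.Negation using (¬∃⟶∀¬)
open import Algebra.Properties.CommutativeMonoid.Sum +-0-commutativeMonoid
  using (sum; ∑-distrib-+; sum-cong-≗; sum-replicate-zero)

private
  variable
    n : ℕ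

∧-true⁻ : ∀ {a b} → a ∧ b ≡ true → a ≡ true × b ≡ true
∧-true⁻ {true} {true} _ = refl , refl

∧-true⁺ : ∀ {a b} → a ≡ true → b ≡ true → a ∧ b ≡ true
∧-true⁺ refl refl = refl

fromBool : Bool → ℕ
fromBool true  = 1
fromBool false = 0

fromBool≤1 : ∀ b → fromBool b ≤ 1
fromBool≤1 true  = ≤-refl
fromBool≤1 false = z≤n

fromBool-nand : ∀ a b → a ∧ b ≡ false → fromBool a + fromBool b ≤ 1
fromBool-nand true  false _ = ≤-refl
fromBool-nand false b     _ = fromBool≤1 b

fromBool-mono : ∀ {a b} → (a ≡ true → b ≡ true) → fromBool a ≤ fromBool b
fromBool-mono {false} _   = z≤n
fromBool-mono {true}  a⇒b rewrite a⇒b refl = ≤-refl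

count : (Fin n → Bool) → ℕ
count P = sum (fromBool ∘ P)

_∖_ : (Fin n → Bool) → Fin n → (Fin n → Bool)
(P ∖ x) v = P v ∧ not (does (x ≟ v))

∖⁺ : ∀ (P : Fin n → Bool) x {v} → P v ≡ true → x ≢ v → (P ∖ x) v ≡ true
∖⁺ P x {v} Pv x≢v with x ≟ v
... | yes x≡v = ⊥-elim (x≢v x≡v)
... | no  _   = ∧-true⁺ Pv refl

∖⁻ : ∀ (P : Fin n → Bool) x {v} → (P ∖ x) v ≡ true → P v ≡ true × x ≢ v
∖⁻ P x {v} P∖xv with x ≟ v
... | no x≢v = proj₁ (∧-true⁻ P∖xv) , x≢v
... | yes _  = ⊥-elim (not-¬ P∖xv (∧-zeroʳ (P v)))

count-cong : {P Q : Fin n → Bool} → (∀ v → P v ≡ Q v) → count P ≡ count Q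
count-cong P≗Q = sum-cong-≗ (cong fromBool ∘ P≗Q)

count-mono : {P Q : Fin n → Bool} → (∀ v → P v ≡ true → Q v ≡ true) → count P ≤ count Q
count-mono {zero}  _   = z≤n
count-mono {suc n} P⊆Q = +-mono-≤ (fromBool-mono (P⊆Q zero)) (count-mono (P⊆Q ∘ suc))

count-none : {P : Fin n → Bool} → (∀ v → P v ≡ false) → count P ≡ 0
count-none {n} P≗∅ = trans (count-cong P≗∅) (sum-replicate-zero n)

count-all : count {n} (λ _ → true) ≡ n
count-all {zero}  = refl
count-all {suc n} = cong suc (count-all {n})

count-split : (P Q : Fin n → Bool) → count P ≡ count (λ v → P v ∧ Q v) + count (λ v → P v ∧ not (Q v))
count-split P Q =
  trans (sum-cong-≗ (λ v → split (P v) (Q v))) (∑-distrib-+ (λ v → fromBool (P v ∧ Q v)) (λ v → fromBool (P v ∧ not (Q v))))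
  where
  split : ∀ a b → fromBool a ≡ fromBool (a ∧ b) + fromBool (a ∧ not b)
  split false _     = refl
  split true  true  = refl
  split true  false = refl

count-∧-≟ : (P : Fin n → Bool) (x : Fin n) → count (λ v → P v ∧ does (x ≟ v)) ≡ fromBool (P x)
count-∧-≟ {suc n} P zero rewrite ∧-identityʳ (P zero) =
  trans (cong (fromBool (P zero) +_) (count-none (λ v → ∧-zeroʳ (P (suc v))))) (+-identityʳ _)
count-∧-≟ {suc n} P (suc x) rewrite ∧-zeroʳ (P zero) = count-∧-≟ (P ∘ suc) x

count-≟ : (x : Fin n) → count (λ v → does (x ≟ v)) ≡ 1
count-≟ = count-∧-≟ (λ _ → true)

≟-true⁻ : {x v : Fin n} → does (x ≟ v) ≡ true → x ≡ v
≟-true⁻ {x = x} {v} x≟v with x ≟ v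
... | yes x≡v = x≡v

count-∖ : (P : Fin n → Bool) (x : Fin n) → count P ≡ fromBool (P x) + count (P ∖ x)
count-∖ P x = trans (count-split P (λ v → does (x ≟ v))) (cong (_+ count (P ∖ x)) (count-∧-≟ P x))

count-remove : (P : Fin n → Bool) {x : Fin n} → P x ≡ true → count P ≡ suc (count (P ∖ x))
count-remove P {x} Px = trans (count-∖ P x) (cong (λ b → fromBool b + count (P ∖ x)) Px)

∣tabulate∣≡count : (P : Fin n → Bool) → ∣ tabulate P ∣ ≡ count P
∣tabulate∣≡count {zero}  P = refl
∣tabulate∣≡count {suc n} P with P zero
... | true  = cong suc (∣tabulate∣≡count (P ∘ suc))
... | false = ∣tabulate∣≡count (P ∘ suc)

countIn : (Fin n → Bool) → List (Fin n) → ℕ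
countIn P []      = 0
countIn P (x ∷ L) = fromBool (P x) + countIn P L

countIn≤length : (P : Fin n → Bool) (L : List (Fin n)) → countIn P L ≤ length L
countIn≤length P []      = z≤n
countIn≤length P (x ∷ L) = +-mono-≤ (fromBool≤1 (P x)) (countIn≤length P L)

countIn-mono : {P Q : Fin n → Bool} → (∀ v → P v ≡ true → Q v ≡ true) → (L : List (Fin n)) → countIn P L ≤ countIn Q L
countIn-mono P⊆Q []      = z≤n
countIn-mono P⊆Q (x ∷ L) = +-mono-≤ (fromBool-mono (P⊆Q x)) (countIn-mono P⊆Q L)

count≤countIn : (P : Fin n → Bool) (L : List (Fin n)) → (∀ v → P v ≡ true → v ∈ L) → count P ≤ countIn P L
count≤countIn P []      covered = ≤-reflexive (count-none (λ v → ¬-not (¬Any[] ∘ covered v)))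
count≤countIn P (x ∷ L) covered = begin
  count P                                  ≡⟨ count-∖ P x ⟩
  fromBool (P x) + count (P ∖ x)           ≤⟨ +-monoʳ-≤ (fromBool (P x)) (count≤countIn (P ∖ x) L covered′) ⟩
  fromBool (P x) + countIn (P ∖ x) L       ≤⟨ +-monoʳ-≤ (fromBool (P x)) (countIn-mono (λ v → proj₁ ∘ ∖⁻ P x) L) ⟩
  fromBool (P x) + countIn P L             ∎
  where
  open ≤-Reasoning
  covered′ : ∀ v → (P ∖ x) v ≡ true → v ∈ L
  covered′ v P∖xv with ∖⁻ P x P∖xv | covered v (proj₁ (∖⁻ P x P∖xv))
  ... | _ , x≢v | here v≡x  = ⊥-elim (x≢v (sym v≡x))
  ... | _ , _   | there v∈L = v∈L

count≤length : (P : Fin n → Bool) (L : List (Fin n)) → (∀ v → P v ≡ true → v ∈ L) → count P ≤ length L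
count≤length P L covered = ≤-trans (count≤countIn P L covered) (countIn≤length P L)

length≤count : (P : Fin n → Bool) {L : List (Fin n)} → Unique L → (∀ v → v ∈ L → P v ≡ true) → length L ≤ count P
length≤count P {[]}    _            _      = z≤n
length≤count P {x ∷ L} (x∉L ∷ uniq) inside = begin
  suc (length L)       ≤⟨ s≤s (length≤count (P ∖ x) uniq (λ v v∈L → ∖⁺ P x (inside v (there v∈L)) (All.lookup x∉L v∈L))) ⟩
  suc (count (P ∖ x))  ≡⟨ count-remove P (inside x (here refl)) ⟨
  count P              ∎
  where open ≤-Reasoning

count≡length : (P : Fin n → Bool) {L : List (Fin n)} → Unique L →
               (∀ v → P v ≡ true → v ∈ L) → (∀ v → v ∈ L → P v ≡ true) → count P ≡ length L
count≡length P {L} uniq covered inside = ≤-antisym (count≤length P L covered) (length≤count P uniq inside)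

Unique-resp-↭ : ∀ {L L′ : List (Fin n)} → L ↭ L′ → Unique L → Unique L′
Unique-resp-↭ L↭L′ = Setoid↭.Unique-resp-↭ (setoid _) (↭⇒↭ₛ L↭L′)

-- Paths and cycles

data Path {n} (K : Fin n → Fin n → Bool) : Fin n → Fin n → List (Fin n) → Set where
  stop : ∀ {x} → Path K x x [ x ]
  hop  : ∀ {x w y L} → K x w ≡ true → Path K w y L → Path K x y (x ∷ L)

data Cycle {n} (K : Fin n → Fin n → Bool) (L : List (Fin n)) : Set where
  cycle : ∀ {x y} → Path K x y L → K y x ≡ true → Cycle K L

module _ {K : Fin n → Fin n → Bool} where

  Path-++ : ∀ {x a b y L₁ L₂} → Path K x a L₁ → K a b ≡ true → Path K b y L₂ → Path K x y (L₁ ++ L₂)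
  Path-++ stop       ab q = hop ab q
  Path-++ (hop xw p) ab q = hop xw (Path-++ p ab q)

  Path-ʳ++ : (∀ u v → K u v ≡ K v u) → ∀ {a b x y L M} →
             Path K a y L → K a b ≡ true → Path K b x M → Path K y x (L ʳ++ M)
  Path-ʳ++ K-sym stop       ab q = hop ab q
  Path-ʳ++ K-sym (hop aw p) ab q = Path-ʳ++ K-sym p (trans (K-sym _ _) aw) (hop ab q)

  Path-reverse : (∀ u v → K u v ≡ K v u) → ∀ {x y L} → Path K x y L → Path K y x (reverse L)
  Path-reverse K-sym stop       = stop
  Path-reverse K-sym (hop xw p) = Path-ʳ++ K-sym p (trans (K-sym _ _) xw) stop

  first∈ : ∀ {x y L} → Path K x y L → x ∈ L
  first∈ stop    = here refl
  first∈ (hop _ _) = here refl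

  last∈ : ∀ {x y L} → Path K x y L → y ∈ L
  last∈ stop      = here refl
  last∈ (hop _ p) = there (last∈ p)

  Path-head : ∀ {x y L} → Path K x y L → ∃ λ t → L ≡ x ∷ t
  Path-head stop              = [] , refl
  Path-head (hop {L = L} _ _) = L , refl

  Path-map : ∀ {K′ : Fin n → Fin n → Bool} → (∀ u v → K u v ≡ true → K′ u v ≡ true) →
             ∀ {x y L} → Path K x y L → Path K′ x y L
  Path-map K⊆K′ stop       = stop
  Path-map K⊆K′ (hop xw p) = hop (K⊆K′ _ _ xw) (Path-map K⊆K′ p)

  clique-path : ∀ {x t} → Unique (x ∷ t) → (∀ u v → u ∈ x ∷ t → v ∈ x ∷ t → u ≢ v → K u v ≡ true) →
                ∃ λ y → Path K x y (x ∷ t)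
  clique-path {x} {[]}    _              _      = x , stop
  clique-path {x} {w ∷ t} (x∉ ∷ unique) clique with clique-path unique (λ u v u∈ v∈ → clique u v (there u∈) (there v∈))
  ... | y , p = y , hop (clique x w (here refl) (there (here refl)) (All.head x∉)) p

  data SplitAt (x y c : Fin n) (L : List (Fin n)) : Set where
    at-start : x ≡ c → SplitAt x y c L
    after    : ∀ {a L₁ L₂} → L ≡ L₁ ++ L₂ → Path K x a L₁ → K a c ≡ true → Path K c y L₂ → SplitAt x y c L

  Path-split : ∀ {x y c L} → Path K x y L → c ∈ L → SplitAt x y c L
  Path-split stop       (here c≡x)  = at-start (sym c≡x)
  Path-split (hop _ _)  (here c≡x)  = at-start (sym c≡x)
  Path-split {x} (hop xw p) (there c∈L) with Path-split p c∈L
  ... | at-start refl               = after refl stop xw p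
  ... | after refl p₁ ac p₂        = after refl (hop xw p₁) ac p₂

  Cycle-rotate : ∀ {L c} → Cycle K L → c ∈ L → ∃₂ λ L′ y → Path K c y L′ × K y c ≡ true × L ↭ L′
  Cycle-rotate (cycle p yx) c∈L with Path-split p c∈L
  ... | at-start refl = _ , _ , p , yx , ↭-refl
  ... | after {L₁ = L₁} {L₂} refl p₁ ac p₂ = L₂ ++ L₁ , _ , Path-++ p₂ yx p₁ , ac , ++-comm L₁ L₂

  Cycle-open : (∀ v → K v v ≡ false) → ∀ {L c} → Cycle K L → c ∈ L →
               ∃₂ λ w y → ∃ λ t → K c w ≡ true × Path K w y t × K y c ≡ true × L ↭ c ∷ t
  Cycle-open K-irrefl C c∈L with Cycle-rotate C c∈L
  ... | _ , _ , stop     , cc , _   = ⊥-elim (not-¬ cc (K-irrefl _))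
  ... | _ , y , hop cw p , yc , L↭ = _ , y , _ , cw , p , yc , L↭

  data Crossing (X Y : Fin n → Bool) : ∀ {x y L} → Path K x y L → Set where
    crossing : ∀ {x a b y L₁ L₂} (p₁ : Path K x a L₁) (ab : K a b ≡ true) (p₂ : Path K b y L₂) →
               Y a ≡ true → X b ≡ true → Crossing X Y (Path-++ p₁ ab p₂)

  -- Unless it is a crossing, each consecutive pair vᵢ vᵢ₊₁ accounts for at most one of Y vᵢ, X vᵢ₊₁.
  crossing-or-sparse : (X Y : Fin n → Bool) → ∀ {x y L} (p : Path K x y L) →
    Crossing X Y p ⊎ (suc (countIn X L + countIn Y L) ≤ length L + fromBool (X x) + fromBool (Y y))
  crossing-or-sparse X Y {x} stop = inj₂ (≤-reflexive (single (fromBool (X x)) (fromBool (Y x))))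
    where
    single : ∀ a b → suc (a + 0 + (b + 0)) ≡ 1 + a + b
    single = solve-∀
  crossing-or-sparse X Y {x} {y} (hop {w = w} {L = L} xw p) with Y x ∧ X w in YxXw
  ... | true  = inj₁ (crossing stop xw p (proj₁ (∧-true⁻ YxXw)) (proj₂ (∧-true⁻ YxXw)))
  ... | false with crossing-or-sparse X Y p
  ...   | inj₁ (crossing p₁ ab p₂ Ya Xb) = inj₁ (crossing (hop xw p₁) ab p₂ Ya Xb)
  ...   | inj₂ sparse = inj₂ (begin
    suc (fromBool (X x) + countIn X L + (fromBool (Y x) + countIn Y L))
      ≡⟨ regroup₁ (fromBool (X x)) (fromBool (Y x)) (countIn X L) (countIn Y L) ⟩
    fromBool (X x) + fromBool (Y x) + suc (countIn X L + countIn Y L)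
      ≤⟨ +-monoʳ-≤ (fromBool (X x) + fromBool (Y x)) sparse ⟩
    fromBool (X x) + fromBool (Y x) + (length L + fromBool (X w) + fromBool (Y y))
      ≡⟨ regroup₂ (fromBool (X x)) (fromBool (Y x)) (length L) (fromBool (X w)) (fromBool (Y y)) ⟩
    fromBool (X x) + length L + fromBool (Y y) + (fromBool (Y x) + fromBool (X w))
      ≤⟨ +-monoʳ-≤ (fromBool (X x) + length L + fromBool (Y y)) (fromBool-nand (Y x) (X w) YxXw) ⟩
    fromBool (X x) + length L + fromBool (Y y) + 1
      ≡⟨ regroup₃ (fromBool (X x)) (length L) (fromBool (Y y)) ⟩
    suc (length L) + fromBool (X x) + fromBool (Y y) ∎)
    where
    open ≤-Reasoning
    regroup₁ : ∀ a b c d → suc (a + c + (b + d)) ≡ a + b + suc (c + d)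
    regroup₁ = solve-∀
    regroup₂ : ∀ a b l c d → a + b + (l + c + d) ≡ a + l + d + (b + c)
    regroup₂ = solve-∀
    regroup₃ : ∀ a l d → a + l + d + 1 ≡ suc l + a + d
    regroup₃ = solve-∀

  crossing-or-short : (X Y : Fin n → Bool) → ∀ {x y L} (p : Path K x y L) → X x ≡ false → Y y ≡ false →
                      Crossing X Y p ⊎ (countIn X L + countIn Y L < length L)
  crossing-or-short X Y {x} {y} {L} p Xx Yy with crossing-or-sparse X Y p
  ... | inj₁ crosses = inj₁ crosses
  ... | inj₂ sparse  = inj₂ (subst (suc (countIn X L + countIn Y L) ≤_) no-loops sparse)
    where
    no-loops : length L + fromBool (X x) + fromBool (Y y) ≡ length L
    no-loops rewrite Xx | Yy = trans (+-identityʳ _) (+-identityʳ _)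

-- Ore's theorem relative to a vertex set

search : {P : Fin n → Set} → (∀ z → Dec (P z)) → ∃ P ⊎ (∀ z → ¬ P z)
search P? with any? P?
... | yes found = inj₁ found
... | no  none  = inj₂ (¬∃⟶∀¬ none)

find : (P : Fin n → Bool) → (∃ λ z → P z ≡ true) ⊎ (∀ z → P z ≡ false)
find P with search (λ z → P z ≟ᵇ true)
... | inj₁ found = inj₁ found
... | inj₂ none  = inj₂ (λ z → ¬-not (none z))

record CycleThrough {n} (K : Fin n → Fin n → Bool) (W : Fin n → Bool) : Set where
  constructor cycle-through
  field
    vertices : List (Fin n)
    closed   : Cycle K vertices
    unique   : Unique vertices
    covers   : ∀ z → W z ≡ true → z ∈ vertices
    inside   : ∀ z → z ∈ vertices → W z ≡ true

module Ore {n} (K : Fin n → Fin n → Bool) (K-sym : ∀ u v → K u v ≡ K v u) (K-irrefl : ∀ v → K v v ≡ false)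
           (W : Fin n → Bool) where

  open DecMembership (_≟_ {n}) using (_∈?_)

  WNeighbour : Fin n → Fin n → Bool
  WNeighbour u v = W v ∧ K u v

  degIn : Fin n → ℕ
  degIn u = count (WNeighbour u)

  OreCondition : Set
  OreCondition = ∀ u v → W u ≡ true → W v ≡ true → u ≢ v → K u v ≡ false → count W ≤ degIn u + degIn v

  no-loop : ∀ v → WNeighbour v v ≡ false
  no-loop v = trans (cong (W v ∧_) (K-irrefl v)) (∧-zeroʳ (W v))

  Saturated : Fin n → List (Fin n) → Set
  Saturated x L = ∀ z → WNeighbour x z ≡ true → z ∈ L

  record WPath : Set where
    constructor wpath
    field
      {start end} : Fin n
      {vertices}  : List (Fin n)
      path        : Path K start end vertices
      unique      : Unique vertices
      inside      : ∀ z → z ∈ vertices → W z ≡ true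
  open WPath

  ∣_∣ᵖ : WPath → ℕ
  ∣ P ∣ᵖ = length (vertices P)

  Longer : WPath → Set
  Longer P = Σ WPath λ P′ → suc ∣ P ∣ᵖ ≤ ∣ P′ ∣ᵖ

  ∣P∣≤∣W∣ : (P : WPath) → ∣ P ∣ᵖ ≤ count W
  ∣P∣≤∣W∣ P = length≤count W (unique P) (inside P)

  WPath-reverse : WPath → WPath
  WPath-reverse (wpath {vertices = L} p u inW) =
    wpath (Path-reverse K-sym p) (Unique-resp-↭ (↭-sym (↭-reverse L)) u) (λ z → inW z ∘ reverse⁻)

  prepend-or-saturated : (P : WPath) → Longer P ⊎ Saturated (start P) (vertices P)
  prepend-or-saturated (wpath {x} {vertices = L} p u inW)
    with search (λ z → (WNeighbour x z ≟ᵇ true) ×-dec ¬? (z ∈? L))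
  ... | inj₂ none = inj₂ (λ z xz → decidable-stable (z ∈? L) (λ z∉L → none z (xz , z∉L)))
  ... | inj₁ (z , xz , z∉L) =
    inj₁ (wpath (hop (trans (K-sym z x) (proj₂ (∧-true⁻ xz))) p) (¬Any⇒All¬ L z∉L ∷ u) inW′ , ≤-refl)
    where
    inW′ : ∀ v → v ∈ z ∷ L → W v ≡ true
    inW′ v (here refl) = proj₁ (∧-true⁻ xz)
    inW′ v (there v∈L) = inW v v∈L

  extend-or-saturated : (P : WPath) → Longer P ⊎ (Saturated (start P) (vertices P) × Saturated (end P) (vertices P))
  extend-or-saturated P with prepend-or-saturated P | prepend-or-saturated (WPath-reverse P)
  ... | inj₁ longer      | _                   = inj₁ longer
  ... | inj₂ _           | inj₁ (P′ , longer) =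
    inj₁ (P′ , subst (λ l → suc l ≤ ∣ P′ ∣ᵖ) (length-reverse (vertices P)) longer)
  ... | inj₂ start-sat   | inj₂ end-sat        = inj₂ (start-sat , λ z yz → reverse⁻ (end-sat z yz))

  CycleOrSingleton : List (Fin n) → Fin n → Set
  CycleOrSingleton L x = (∃ λ L′ → Cycle K L′ × L ↭ L′) ⊎ (L ≡ [ x ])

  module _ (two≤∣W∣ : 2 ≤ count W) (ore-condition : OreCondition) where

    saturated-path-closes : (P : WPath) → Saturated (start P) (vertices P) → Saturated (end P) (vertices P) →
                            CycleOrSingleton (vertices P) (start P)
    saturated-path-closes (wpath {x} {y} {L} p u inW) x-sat y-sat with K y x in yx
    ... | true  = inj₁ (L , cycle p yx , ↭-refl)
    ... | false with crossing-or-short (WNeighbour x) (WNeighbour y) p (no-loop x) (no-loop y)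
    ...   | inj₁ (crossing {L₁ = L₁} {L₂ = L₂} p₁ ab p₂ ya xb) =
      inj₁ (L₁ ++ reverse L₂ , cycle (Path-++ p₁ (edge ya) (Path-reverse K-sym p₂)) (edge xb) ,
            ++⁺ˡ L₁ (↭-sym (↭-reverse L₂)))
      where
      edge : ∀ {a b} → WNeighbour a b ≡ true → K b a ≡ true
      edge {a} {b} ab = trans (K-sym b a) (proj₂ (∧-true⁻ ab))
    ...   | inj₂ short with p
    ...     | stop    = inj₂ refl
    ...     | hop _ q = ⊥-elim (<-irrefl refl (begin-strict
      count W                                                    ≤⟨ ore-condition x y (inW x (here refl)) (inW y (last∈ p)) x≢y x≁y ⟩
      degIn x + degIn y                                          ≤⟨ +-mono-≤ (count≤countIn _ L x-sat) (count≤countIn _ L y-sat) ⟩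
      countIn (WNeighbour x) L + countIn (WNeighbour y) L       <⟨ short ⟩
      length L                                                   ≤⟨ length≤count W u inW ⟩
      count W                                                    ∎))
      where
      open ≤-Reasoning
      x≢y : x ≢ y
      x≢y refl = Unique[x∷xs]⇒x∉xs u (last∈ q)
      x≁y : K x y ≡ false
      x≁y = trans (K-sym x y) yx

    neighbour-on-path : ∀ {x t} → Unique (x ∷ t) → (∀ v → v ∈ x ∷ t → W v ≡ true) → Saturated x (x ∷ t) →
                        ∀ {z} → W z ≡ true → z ∉ x ∷ t → ∃ λ c → c ∈ x ∷ t × K z c ≡ true
    neighbour-on-path {x} {t} u inW x-sat {z} Wz z∉L with search (λ c → (c ∈? (x ∷ t)) ×-dec (K z c ≟ᵇ true))
    ... | inj₁ (c , c∈L , zc) = c , c∈L , zc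
    ... | inj₂ none = ⊥-elim (<-irrefl refl (begin-strict
      degIn z + length t                        <⟨ m<m+n (degIn z + length t) (s≤s z≤n) ⟩
      degIn z + length t + 2                    ≡⟨ regroup (degIn z) (length t) ⟩
      degIn z + length (z ∷ x ∷ t)             ≤⟨ +-monoʳ-≤ (degIn z) (length≤count (λ v → W v ∧ not (K z v)) u′ non-neighbours) ⟩
      degIn z + count (λ v → W v ∧ not (K z v)) ≡⟨ count-split W (K z) ⟨
      count W                                   ≤⟨ ore-condition z x Wz (inW x (here refl)) z≢x z≁x ⟩
      degIn z + degIn x                         ≤⟨ +-monoʳ-≤ (degIn z) (count≤length (WNeighbour x) t x-neighbours-in-t) ⟩
      degIn z + length t                        ∎))
      where
      open ≤-Reasoning
      regroup : ∀ d l → d + l + 2 ≡ d + suc (suc l)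
      regroup d l = trans (+-assoc d l 2) (cong (d +_) (+-comm l 2))
      z≢x : z ≢ x
      z≢x refl = z∉L (here refl)
      non-adjacent : ∀ v → v ∈ x ∷ t → K z v ≡ false
      non-adjacent v v∈L = ¬-not (λ zv → none v (v∈L , zv))
      z≁x : K z x ≡ false
      z≁x = non-adjacent x (here refl)
      u′ : Unique (z ∷ x ∷ t)
      u′ = ¬Any⇒All¬ (x ∷ t) z∉L ∷ u
      non-neighbours : ∀ v → v ∈ z ∷ x ∷ t → W v ∧ not (K z v) ≡ true
      non-neighbours v (here refl)  rewrite K-irrefl z = ∧-true⁺ Wz refl
      non-neighbours v (there v∈L) rewrite non-adjacent v v∈L = ∧-true⁺ (inW v v∈L) refl
      x-neighbours-in-t : ∀ v → WNeighbour x v ≡ true → v ∈ t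
      x-neighbours-in-t v xv with x-sat v xv
      ... | here refl  = ⊥-elim (not-¬ (proj₂ (∧-true⁻ xv)) (K-irrefl x))
      ... | there v∈t = v∈t

    path-around : ∀ {L x c} → CycleOrSingleton L x → c ∈ L → ∃₂ λ L′ y → Path K c y L′ × L ↭ L′
    path-around (inj₁ (L′ , C , L↭L′)) c∈L with Cycle-rotate C (∈-resp-↭ L↭L′ c∈L)
    ... | L″ , y , p , _ , L′↭L″ = L″ , y , p , ↭-trans L↭L′ L′↭L″
    path-around (inj₂ refl) (here refl) = _ , _ , stop , ↭-refl

    covered-or-missing : (L : List (Fin n)) → (∀ z → W z ≡ true → z ∈ L) ⊎ (∃ λ z → W z ≡ true × z ∉ L)
    covered-or-missing L with search (λ z → (W z ≟ᵇ true) ×-dec ¬? (z ∈? L))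
    ... | inj₁ missing = inj₂ missing
    ... | inj₂ none    = inj₁ (λ z Wz → decidable-stable (z ∈? L) (λ z∉L → none z (Wz , z∉L)))

    detour : (P : WPath) → Saturated (start P) (vertices P) → CycleOrSingleton (vertices P) (start P) →
             ∀ {z} → W z ≡ true → z ∉ vertices P → Longer P
    detour P x-sat closed {z} Wz z∉L with Path-head (path P)
    ... | t , refl with neighbour-on-path (unique P) (inside P) x-sat Wz z∉L
    ... | c , c∈L , zc with path-around closed c∈L
    ... | L′ , y , p , L↭L′ =
      wpath (hop zc p) (¬Any⇒All¬ L′ (z∉L ∘ ∈-resp-↭ (↭-sym L↭L′)) ∷ Unique-resp-↭ L↭L′ (unique P)) inW′ ,
      s≤s (≤-reflexive (↭-length L↭L′))
      where
      inW′ : ∀ v → v ∈ z ∷ L′ → W v ≡ true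
      inW′ v (here refl)  = Wz
      inW′ v (there v∈L′) = inside P v (∈-resp-↭ (↭-sym L↭L′) v∈L′)

    spanning-cycle-or-longer : (P : WPath) → CycleThrough K W ⊎ Longer P
    spanning-cycle-or-longer P with extend-or-saturated P
    ... | inj₁ longer = inj₂ longer
    ... | inj₂ (x-sat , y-sat) with saturated-path-closes P x-sat y-sat | covered-or-missing (vertices P)
    ...   | closed               | inj₂ (z , Wz , z∉L) = inj₂ (detour P x-sat closed Wz z∉L)
    ...   | inj₁ (L′ , C , L↭L′) | inj₁ covered =
      inj₁ (cycle-through L′ C (Unique-resp-↭ L↭L′ (unique P)) (λ z → ∈-resp-↭ L↭L′ ∘ covered z)
                               (λ z → inside P z ∘ ∈-resp-↭ (↭-sym L↭L′)))
    ...   | inj₂ L≡[x]           | inj₁ covered =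
      ⊥-elim (≤⇒≯ (count≤length W (vertices P) covered) (subst (_< count W) (sym (cong length L≡[x])) two≤∣W∣))

    grow : (fuel : ℕ) (P : WPath) → count W ≤ fuel + ∣ P ∣ᵖ → CycleThrough K W
    grow fuel P bound with spanning-cycle-or-longer P
    ... | inj₁ C = C
    ... | inj₂ (P′ , longer) with fuel
    ...   | zero      = ⊥-elim (<⇒≱ (≤-trans longer (∣P∣≤∣W∣ P′)) bound)
    ...   | suc fuel′ = grow fuel′ P′ (≤-trans bound (≤-trans (≤-reflexive (sym (+-suc fuel′ ∣ P ∣ᵖ))) (+-monoʳ-≤ fuel′ longer)))

    ore : CycleThrough K W
    ore with find W
    ... | inj₁ (x , Wx) = grow (count W) (wpath stop ([] ∷ []) (λ { z (here refl) → Wx })) (m≤m+n (count W) 1)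
    ... | inj₂ none     = ⊥-elim (<⇒≱ two≤∣W∣ (≤-trans (≤-reflexive (count-none none)) z≤n))

-- The closure lemma

module Closure {n} (A : Fin n → Fin n → Bool) (A-sym : ∀ u v → A u v ≡ A v u) (A-irrefl : ∀ v → A v v ≡ false)
               (K : Fin n → Fin n → Bool) (K-sym : ∀ u v → K u v ≡ K v u)
               (A⊆K : ∀ u v → A u v ≡ true → K u v ≡ true)
               (closure-condition : ∀ u v → K u v ≡ true → A u v ≡ false → n ≤ count (A u) + count (A v)) where

  nonEdge : Fin n → Fin n → ℕ
  nonEdge u v = fromBool (not (A u v))

  nonEdges : ∀ {x y L} → Path K x y L → ℕ
  nonEdges stop                    = 0
  nonEdges (hop {x} {w} _ p) = nonEdge x w + nonEdges p

  nonEdges-++ : ∀ {x a b y L₁ L₂} (p : Path K x a L₁) (ab : K a b ≡ true) (q : Path K b y L₂) →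
                nonEdges (Path-++ p ab q) ≡ nonEdges p + nonEdge a b + nonEdges q
  nonEdges-++ stop              ab q = refl
  nonEdges-++ {a = a} {b} (hop {x} {w} _ p) ab q =
    trans (cong (nonEdge x w +_) (nonEdges-++ p ab q)) (regroup (nonEdge x w) (nonEdges p) (nonEdge a b) (nonEdges q))
    where
    regroup : ∀ a b c d → a + (b + c + d) ≡ a + b + c + d
    regroup = solve-∀

  nonEdge-sym : ∀ u v → nonEdge u v ≡ nonEdge v u
  nonEdge-sym u v = cong (fromBool ∘ not) (A-sym u v)

  nonEdges-ʳ++ : ∀ {a b x y L M} (p : Path K a y L) (ab : K a b ≡ true) (q : Path K b x M) →
                 nonEdges (Path-ʳ++ K-sym p ab q) ≡ nonEdges p + nonEdge a b + nonEdges q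
  nonEdges-ʳ++ stop              ab q = refl
  nonEdges-ʳ++ {a} {b} (hop {w = w} aw p) ab q = begin
    nonEdges (Path-ʳ++ K-sym p _ (hop ab q))       ≡⟨ nonEdges-ʳ++ p _ (hop ab q) ⟩
    nonEdges p + nonEdge w a + (nonEdge a b + nonEdges q) ≡⟨ cong (λ e → nonEdges p + e + _) (nonEdge-sym w a) ⟩
    nonEdges p + nonEdge a w + (nonEdge a b + nonEdges q) ≡⟨ regroup (nonEdges p) (nonEdge a w) (nonEdge a b) (nonEdges q) ⟩
    nonEdge a w + nonEdges p + nonEdge a b + nonEdges q   ∎
    where
    open ≡-Reasoning
    regroup : ∀ p e f q → p + e + (f + q) ≡ e + p + f + q
    regroup = solve-∀

  nonEdges-reverse : ∀ {x y L} (p : Path K x y L) → nonEdges (Path-reverse K-sym p) ≡ nonEdges p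
  nonEdges-reverse stop = refl
  nonEdges-reverse {x} (hop {w = w} xw p) =
    trans (nonEdges-ʳ++ p _ stop)
          (trans (+-identityʳ _) (trans (cong (nonEdges p +_) (nonEdge-sym w x)) (+-comm (nonEdges p) (nonEdge x w))))

  data NonEdgeSplit : ∀ {x y L} → Path K x y L → Set where
    split : ∀ {x a b y L₁ L₂} (p₁ : Path K x a L₁) (ab : K a b ≡ true) (p₂ : Path K b y L₂) →
            A a b ≡ false → NonEdgeSplit (Path-++ p₁ ab p₂)

  edges-or-nonEdge : ∀ {x y L} (p : Path K x y L) → Path A x y L ⊎ NonEdgeSplit p
  edges-or-nonEdge stop = inj₁ stop
  edges-or-nonEdge (hop {x} {w} xw p) with A x w in Axw
  ... | false = inj₂ (split stop xw p Axw)
  ... | true with edges-or-nonEdge p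
  ...   | inj₁ pA                 = inj₁ (hop Axw pA)
  ...   | inj₂ (split p₁ ab p₂ a≁b) = inj₂ (split (hop xw p₁) ab p₂ a≁b)

  Spanning : List (Fin n) → Set
  Spanning L = ∀ z → z ∈ L

  edge⇒nonEdge≡0 : ∀ {u v} → A u v ≡ true → nonEdge u v ≡ 0
  edge⇒nonEdge≡0 uv = cong (fromBool ∘ not) uv

  nonEdge⇒nonEdge≡1 : ∀ {u v} → A u v ≡ false → nonEdge u v ≡ 1
  nonEdge⇒nonEdge≡1 u≁v = cong (fromBool ∘ not) u≁v

  -- A non-edge yx closing the cycle is traded, through a crossing that deg x + deg y ≥ n
  -- forces, for two edges of A; this lowers the number of non-edges on the cycle.
  mutual
    eliminate-nonEdges : (fuel : ℕ) → ∀ {x y L} (p : Path K x y L) (yx : K y x ≡ true) → nonEdges p + nonEdge y x ≤ fuel →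
           Unique L → Spanning L → CycleThrough A (λ _ → true)
    eliminate-nonEdges fuel {x} {y} p yx bound u span with A y x in Ayx
    ... | false = eliminate-closing-nonEdge fuel p yx Ayx (subst (_≤ fuel) (+-comm (nonEdges p) 1) bound) u span
    ... | true with edges-or-nonEdge p
    ...   | inj₁ pA = cycle-through _ (cycle pA Ayx) u (λ z _ → span z) (λ _ _ → refl)
    ...   | inj₂ (split {L₁ = L₁} {L₂ = L₂} p₁ ab p₂ a≁b) =
      eliminate-closing-nonEdge fuel (Path-++ p₂ yx p₁) ab a≁b (subst (_≤ fuel) rotated bound)
        (Unique-resp-↭ (++-comm L₁ L₂) u) (λ z → ∈-resp-↭ (++-comm L₁ L₂) (span z))
      where
      rotated : nonEdges (Path-++ p₁ ab p₂) + 0 ≡ suc (nonEdges (Path-++ p₂ yx p₁))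
      rotated = begin
        nonEdges (Path-++ p₁ ab p₂) + 0                              ≡⟨ cong (_+ 0) (nonEdges-++ p₁ ab p₂) ⟩
        nonEdges p₁ + nonEdge _ _ + nonEdges p₂ + 0                  ≡⟨ cong (λ e → nonEdges p₁ + e + nonEdges p₂ + 0) (nonEdge⇒nonEdge≡1 a≁b) ⟩
        nonEdges p₁ + 1 + nonEdges p₂ + 0                             ≡⟨ regroup (nonEdges p₁) (nonEdges p₂) ⟩
        suc (nonEdges p₂ + 0 + nonEdges p₁)                           ≡⟨ cong (λ e → suc (nonEdges p₂ + e + nonEdges p₁)) (edge⇒nonEdge≡0 Ayx) ⟨
        suc (nonEdges p₂ + nonEdge y x + nonEdges p₁)                 ≡⟨ cong suc (nonEdges-++ p₂ yx p₁) ⟨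
        suc (nonEdges (Path-++ p₂ yx p₁))                             ∎
        where
        open ≡-Reasoning
        regroup : ∀ a b → a + 1 + b + 0 ≡ suc (b + 0 + a)
        regroup = solve-∀

    eliminate-closing-nonEdge : (fuel : ℕ) → ∀ {x y L} (p : Path K x y L) (yx : K y x ≡ true) → A y x ≡ false →
                      suc (nonEdges p) ≤ fuel → Unique L → Spanning L → CycleThrough A (λ _ → true)
    eliminate-closing-nonEdge fuel {x} {y} {L} p yx y≁x bound u span with crossing-or-short (A x) (A y) p (A-irrefl x) (A-irrefl y)
    ... | inj₂ short = ⊥-elim (<-irrefl refl (begin-strict
      n                                  ≤⟨ closure-condition y x yx y≁x ⟩
      count (A y) + count (A x)          ≡⟨ +-comm (count (A y)) (count (A x)) ⟩
      count (A x) + count (A y)          ≤⟨ +-mono-≤ (count≤countIn (A x) L (λ z _ → span z)) (count≤countIn (A y) L (λ z _ → span z)) ⟩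
      countIn (A x) L + countIn (A y) L  <⟨ short ⟩
      length L                           ≤⟨ length≤count (λ _ → true) u (λ _ _ → refl) ⟩
      count {n} (λ _ → true)             ≡⟨ count-all ⟩
      n                                  ∎))
      where open ≤-Reasoning
    ... | inj₁ (crossing {L₁ = L₁} {L₂ = L₂} p₁ ab p₂ ya xb) with fuel
    ...   | zero      = ⊥-elim (n≮0 bound)
    ...   | suc fuel′ =
      eliminate-nonEdges fuel′ (Path-++ p₁ (A⊆K _ _ ay) (Path-reverse K-sym p₂)) (A⊆K _ _ bx) (≤-pred (≤-trans (s≤s fewer) bound))
        (Unique-resp-↭ L↭L′ u) (λ z → ∈-resp-↭ L↭L′ (span z))
      where
      ay = trans (A-sym _ y) ya
      bx = trans (A-sym _ x) xb
      L↭L′ : L₁ ++ L₂ ↭ L₁ ++ reverse L₂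
      L↭L′ = ++⁺ˡ L₁ (↭-sym (↭-reverse L₂))
      fewer : nonEdges (Path-++ p₁ (A⊆K _ _ ay) (Path-reverse K-sym p₂)) + nonEdge _ x ≤ nonEdges (Path-++ p₁ ab p₂)
      fewer = begin
        nonEdges (Path-++ p₁ (A⊆K _ _ ay) (Path-reverse K-sym p₂)) + nonEdge _ x
          ≡⟨ cong₂ _+_ (nonEdges-++ p₁ _ (Path-reverse K-sym p₂)) (edge⇒nonEdge≡0 bx) ⟩
        nonEdges p₁ + nonEdge _ y + nonEdges (Path-reverse K-sym p₂) + 0
          ≡⟨ cong₂ (λ e r → nonEdges p₁ + e + r + 0) (edge⇒nonEdge≡0 ay) (nonEdges-reverse p₂) ⟩
        nonEdges p₁ + 0 + nonEdges p₂ + 0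
          ≡⟨ +-identityʳ _ ⟩
        nonEdges p₁ + 0 + nonEdges p₂
          ≤⟨ +-monoˡ-≤ (nonEdges p₂) (+-monoʳ-≤ (nonEdges p₁) z≤n) ⟩
        nonEdges p₁ + nonEdge _ _ + nonEdges p₂
          ≡⟨ nonEdges-++ p₁ ab p₂ ⟨
        nonEdges (Path-++ p₁ ab p₂) ∎
        where open ≤-Reasoning

  closure-lemma : CycleThrough K (λ _ → true) → CycleThrough A (λ _ → true)
  closure-lemma (cycle-through L (cycle p yx) u covers _) = eliminate-nonEdges _ p yx ≤-refl u (λ z → covers z refl)

Path⇒Linked : ∀ {n} {K : Fin n → Fin n → Bool} {x y z L} → Path K x y L → K y z ≡ true →
              Linked (λ u v → K u v ≡ true) (L ∷ʳ z)
Path⇒Linked stop       yz = yz ∷ [-]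
Path⇒Linked (hop xw p) yz with Path-head p
... | _ , refl = xw ∷ Path⇒Linked p yz

hamiltonian : ∀ {n} (G : Graph n) → 3 ≤ n → CycleThrough (adj G) (λ _ → true) → Hamiltonian G
hamiltonian {n} G 3≤n (cycle-through L (cycle p yx) u covers _) with Path-head p
... | t , refl = _ , t , u , (λ z → covers z refl) , three≤length , Path⇒Linked p yx
  where
  three≤length : 3 ≤ length L
  three≤length = ≤-trans 3≤n (subst (_≤ length L) count-all (count≤length (λ _ → true) L covers))

record Enumeration (P : Fin n → Bool) (k : ℕ) : Set where
  field
    vertex          : Fin k → Fin n
    position        : ∀ x → P x ≡ true → Fin k
    vertex-P        : ∀ i → P (vertex i) ≡ true
    vertex-position : ∀ x (Px : P x ≡ true) → vertex (position x Px) ≡ x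
    position-vertex : ∀ i (Pv : P (vertex i) ≡ true) → position (vertex i) Pv ≡ i

index-∈-lookup : ∀ {L : List (Fin n)} i → Any.index (∈-lookup {xs = L} i) ≡ i
index-∈-lookup {L = _ ∷ _} zero    = refl
index-∈-lookup {L = _ ∷ _} (suc i) = cong suc (index-∈-lookup i)

listing : (P : Fin n → Bool) → Σ (List (Fin n)) λ L →
          Unique L × (∀ x → P x ≡ true → x ∈ L) × (∀ x → x ∈ L → P x ≡ true)
listing {n} P = filterᵇ P (allFin n) , filter⁺ (T? ∘ P) (allFin⁺ n) ,
                (λ x Px → ∈-filter⁺ (T? ∘ P) (∈-allFin x) (Equivalence.from T-≡ Px)) ,
                (λ x x∈ → Equivalence.to T-≡ (proj₂ (∈-filter⁻ (T? ∘ P) {xs = allFin n} x∈)))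

-- Opaque: only the Enumeration interface is used, and unfolding the construction makes
-- conversion checking of the block adjacencies below blow up.
opaque
  enumerate : (P : Fin n → Bool) → Enumeration P (count P)
  enumerate P with listing P
  ... | members , unique , member⁺ , member⁻ = subst (Enumeration P) length≡count (record
    { vertex          = lookup members
    ; position        = λ x → Any.index ∘ member⁺ x
    ; vertex-P        = λ i → member⁻ _ (∈-lookup i)
    ; vertex-position = λ x Px → sym (lookup-index (member⁺ x Px))
    ; position-vertex = λ i Pv → trans (cong Any.index (unique⇒irrelevant unique (member⁺ _ Pv) (∈-lookup i))) (index-∈-lookup i)
    })
    where
    length≡count : length members ≡ count P
    length≡count = sym (count≡length P unique member⁺ member⁻)

module ThreeBlocks {P₁ P₂ P₃ : Fin n → Bool} {k₁ k₂ k₃ : ℕ}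
                   (E₁ : Enumeration P₁ k₁) (E₂ : Enumeration P₂ k₂) (E₃ : Enumeration P₃ k₃)
                   (disjoint₁₂ : ∀ x → P₁ x ≡ true → P₂ x ≡ false)
                   (disjoint₁₃ : ∀ x → P₁ x ≡ true → P₃ x ≡ false)
                   (disjoint₂₃ : ∀ x → P₂ x ≡ true → P₃ x ≡ false)
                   (exhaustive : ∀ x → P₁ x ≡ false → P₂ x ≡ false → P₃ x ≡ true) where

  private
    module E₁ = Enumeration E₁
    module E₂ = Enumeration E₂
    module E₃ = Enumeration E₃

  Blocks : Set
  Blocks = Fin k₁ ⊎ (Fin k₂ ⊎ Fin k₃)

  data BlockView (x : Fin n) : Blocks → Set where
    in₁ : (p : P₁ x ≡ true) → BlockView x (inj₁ (E₁.position x p))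
    in₂ : (p : P₂ x ≡ true) → BlockView x (inj₂ (inj₁ (E₂.position x p)))
    in₃ : (p : P₃ x ≡ true) → BlockView x (inj₂ (inj₂ (E₃.position x p)))

  classify : ∀ x → Σ Blocks (BlockView x)
  classify x with P₁ x in p₁ | P₂ x in p₂
  ... | true  | _     = _ , in₁ p₁
  ... | false | true  = _ , in₂ p₂
  ... | false | false = _ , in₃ (exhaustive x p₁ p₂)

  block : Fin n → Blocks
  block = proj₁ ∘ classify

  unblock : Blocks → Fin n
  unblock (inj₁ i)        = E₁.vertex i
  unblock (inj₂ (inj₁ i)) = E₂.vertex i
  unblock (inj₂ (inj₂ i)) = E₃.vertex i

  unblock-block : ∀ x → unblock (block x) ≡ x
  unblock-block x with classify x
  ... | _ , in₁ p = E₁.vertex-position x p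
  ... | _ , in₂ p = E₂.vertex-position x p
  ... | _ , in₃ p = E₃.vertex-position x p

  block-unblock : ∀ b → block (unblock b) ≡ b
  block-unblock (inj₁ i) with classify (E₁.vertex i)
  ... | _ , in₁ p = cong inj₁ (E₁.position-vertex i p)
  ... | _ , in₂ p = ⊥-elim (not-¬ p (disjoint₁₂ _ (E₁.vertex-P i)))
  ... | _ , in₃ p = ⊥-elim (not-¬ p (disjoint₁₃ _ (E₁.vertex-P i)))
  block-unblock (inj₂ (inj₁ i)) with classify (E₂.vertex i)
  ... | _ , in₁ p = ⊥-elim (not-¬ (E₂.vertex-P i) (disjoint₁₂ _ p))
  ... | _ , in₂ p = cong (inj₂ ∘ inj₁) (E₂.position-vertex i p)
  ... | _ , in₃ p = ⊥-elim (not-¬ p (disjoint₂₃ _ (E₂.vertex-P i)))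
  block-unblock (inj₂ (inj₂ i)) with classify (E₃.vertex i)
  ... | _ , in₁ p = ⊥-elim (not-¬ (E₃.vertex-P i) (disjoint₁₃ _ p))
  ... | _ , in₂ p = ⊥-elim (not-¬ (E₃.vertex-P i) (disjoint₂₃ _ p))
  ... | _ , in₃ p = cong (inj₂ ∘ inj₂) (E₃.position-vertex i p)

  iso : Fin n ↔ Fin (k₁ + (k₂ + k₃))
  iso = (↔-sym +↔⊎ ↔-∘ (↔-id _ ⊎-↔ ↔-sym +↔⊎)) ↔-∘ mk↔ₛ′ block unblock block-unblock unblock-block

-- The clique partition

complete-adj : ∀ {m} {i j : Fin m} → i ≢ j → adj (complete m) i j ≡ true
complete-adj {i = i} {j} i≢j with i ≟ j
... | yes i≡j = ⊥-elim (i≢j i≡j)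
... | no  _   = refl

sumGraph-join : ∀ {a b} c (G : Graph a) (H : Graph b) x y →
                adj (sumGraph c G H) (join a b x) (join a b y) ≡ sumAdj c G H x y
sumGraph-join {a} {b} c G H x y = cong₂ (sumAdj c G H) (splitAt-join a b x) (splitAt-join a b y)

clique-adj : ∀ {n k} (G : Graph n) {P : Fin n → Bool} (E : Enumeration P k) →
             (∀ u v → P u ≡ true → P v ≡ true → u ≢ v → adj G u v ≡ true) →
             ∀ u v (Pu : P u ≡ true) (Pv : P v ≡ true) →
             adj G u v ≡ adj (complete k) (Enumeration.position E u Pu) (Enumeration.position E v Pv)
clique-adj G {P} E clique u v Pu Pv with u ≟ v
... | yes refl = trans (irrefl G u) (sym (subst (λ Pv → adj (complete _) (position u Pu) (position u Pv) ≡ false)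
                                             (≡-irrelevant Pu Pv) (irrefl (complete _) (position u Pu))))
  where open Enumeration E
... | no u≢v  = trans (clique u v Pu Pv u≢v) (sym (complete-adj (u≢v ∘ injective)))
  where
  open Enumeration E
  injective : position u Pu ≡ position v Pv → u ≡ v
  injective eq = trans (sym (vertex-position u Pu)) (trans (cong vertex eq) (vertex-position v Pv))

2≤count-all : 3 ≤ n → 2 ≤ count {n} (λ _ → true)
2≤count-all 3≤n = subst (2 ≤_) (sym count-all) (≤-trans (n≤1+n 2) 3≤n)

complete⇒hamiltonian : ∀ {n} (G : Graph n) → 3 ≤ n → (∀ u v → u ≢ v → adj G u v ≡ true) → Hamiltonian G
complete⇒hamiltonian {n} G 3≤n adjacent =
  hamiltonian G 3≤n (Ore.ore (adj G) (Graph.sym G) (irrefl G) (λ _ → true) (2≤count-all 3≤n) no-non-edges)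
  where
  no-non-edges : Ore.OreCondition (adj G) (Graph.sym G) (irrefl G) (λ _ → true)
  no-non-edges u v _ _ u≢v u≁v = ⊥-elim (not-¬ (adjacent u v u≢v) u≁v)

degree-sum-bound : ∀ {a r δ d₁ d₂} → a ≢ r → r ≤ δ → a ≤ suc d₁ → a ≤ suc d₂ → δ ≤ suc d₁ → δ ≤ suc d₂ →
                   a + r ≤ suc (d₁ + d₂)
degree-sum-bound {a} {r} {δ} {d₁} {d₂} a≢r r≤δ a≤d₁ a≤d₂ δ≤d₁ δ≤d₂ with <-cmp a r
... | tri≈ _ a≡r _ = ⊥-elim (a≢r a≡r)
... | tri< a<r _ _ = subst (a + r ≤_) (+-suc d₁ d₂) (+-mono-≤ (≤-pred (≤-trans a<r (≤-trans r≤δ δ≤d₁))) (≤-trans r≤δ δ≤d₂))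
... | tri> _ _ r<a = subst (a + r ≤_) (cong suc (+-comm d₂ d₁)) (+-mono-≤ a≤d₂ (≤-pred (≤-trans r<a a≤d₁)))

module CliquePartition {n} (G : Graph n) (δ ω : ℕ) (two-connected : TwoConnected G) (min-degree : IsMinDegree G δ)
             (clique-number : IsCliqueNumber G ω) (n≤δ+ω : n ≤ δ + ω) where

  V : Set
  V = Fin n

  E : V → V → Bool
  E = adj G

  E-sym : ∀ u v → E u v ≡ E v u
  E-sym = Graph.sym G

  deg : V → ℕ
  deg v = count (E v)

  δ≤deg : ∀ v → δ ≤ deg v
  δ≤deg v = subst (δ ≤_) (∣tabulate∣≡count (E v)) (proj₁ min-degree v)

  3≤n : 3 ≤ n
  3≤n = proj₁ two-connected

  S : Subset n
  S = proj₁ (proj₁ clique-number)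

  C : V → Bool
  C = Vec.lookup S

  C-clique : ∀ u v → C u ≡ true → C v ≡ true → u ≢ v → E u v ≡ true
  C-clique u v Cu Cv = proj₁ (proj₂ (proj₁ clique-number)) u v (lookup⇒[]= u S Cu) (lookup⇒[]= v S Cv)

  |C|≡ω : count C ≡ ω
  |C|≡ω = trans (sym (∣tabulate∣≡count C)) (trans (cong ∣_∣ (tabulate∘lookup S)) (proj₂ (proj₂ (proj₁ clique-number))))

  R : V → Bool
  R = not ∘ C

  r : ℕ
  r = count R

  ω+r≡n : ω + r ≡ n
  ω+r≡n = trans (cong (_+ r) (sym |C|≡ω)) (trans (sym (count-split (λ _ → true) C)) count-all)

  r≤δ : r ≤ δ
  r≤δ = +-cancelˡ-≤ ω r δ (subst (_≤ ω + δ) (sym ω+r≡n) (subst (n ≤_) (+-comm δ ω) n≤δ+ω))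

  R⇒¬C : ∀ {z} → R z ≡ true → C z ≡ false
  R⇒¬C = not-injective

  ¬C⇒R : ∀ {z} → C z ≡ false → R z ≡ true
  ¬C⇒R = cong not

  C≢R : ∀ {c z} → C c ≡ true → R z ≡ true → c ≢ z
  C≢R Cc Rz refl = not-¬ Cc (R⇒¬C Rz)

  touchesR : V → Bool
  touchesR c = ⌊ any? (λ z → E c z ∧ R z ≟ᵇ true) ⌋

  touchesR⁺ : ∀ {c z} → E c z ≡ true → R z ≡ true → touchesR c ≡ true
  touchesR⁺ cz Rz = Equivalence.to T-≡ (fromWitness (_ , ∧-true⁺ cz Rz))

  touchesR⁻ : ∀ c → touchesR c ≡ true → ∃ λ z → E c z ∧ R z ≡ true
  touchesR⁻ c tc = toWitness {a? = any? (λ z → E c z ∧ R z ≟ᵇ true)} (Equivalence.from T-≡ tc)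

  A B : V → Bool
  A c = C c ∧ touchesR c
  B c = C c ∧ not (touchesR c)

  α β : ℕ
  α = count A
  β = count B

  α+β≡ω : α + β ≡ ω
  α+β≡ω = trans (sym (count-split C touchesR)) |C|≡ω

  A⇒C : ∀ {c} → A c ≡ true → C c ≡ true
  A⇒C = proj₁ ∘ ∧-true⁻

  B⇒C : ∀ {c} → B c ≡ true → C c ≡ true
  B⇒C = proj₁ ∘ ∧-true⁻

  A⇒¬B : ∀ {c} → A c ≡ true → B c ≡ false
  A⇒¬B {c} Ac = trans (cong (λ t → C c ∧ not t) (proj₂ (∧-true⁻ Ac))) (∧-zeroʳ (C c))

  R⇒¬B : ∀ {c} → R c ≡ true → B c ≡ false
  R⇒¬B Rc rewrite R⇒¬C Rc = refl

  A≢B : ∀ {a b} → A a ≡ true → B b ≡ true → a ≢ b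
  A≢B Aa Bb refl = not-¬ Bb (A⇒¬B Aa)

  vertex-cases : ∀ c → A c ≡ true ⊎ B c ≡ true ⊎ R c ≡ true
  vertex-cases c with C c | touchesR c
  ... | true  | true  = inj₁ refl
  ... | true  | false = inj₂ (inj₁ refl)
  ... | false | _     = inj₂ (inj₂ refl)

  C⇒A⊎B : ∀ {c} → C c ≡ true → A c ≡ true ⊎ B c ≡ true
  C⇒A⊎B {c} Cc with vertex-cases c
  ... | inj₁ Ac        = inj₁ Ac
  ... | inj₂ (inj₁ Bc) = inj₂ Bc
  ... | inj₂ (inj₂ Rc) = ⊥-elim (C≢R Cc Rc refl)

  ¬B⇒A⊎R : ∀ {c} → B c ≡ false → A c ≡ true ⊎ R c ≡ true
  ¬B⇒A⊎R {c} ¬Bc with vertex-cases c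
  ... | inj₁ Ac        = inj₁ Ac
  ... | inj₂ (inj₁ Bc) = ⊥-elim (not-¬ Bc ¬Bc)
  ... | inj₂ (inj₂ Rc) = inj₂ Rc

  ¬A¬B⇒R : ∀ {x} → A x ≡ false → B x ≡ false → R x ≡ true
  ¬A¬B⇒R {x} ¬Ax ¬Bx with vertex-cases x
  ... | inj₁ Ax        = ⊥-elim (not-¬ Ax ¬Ax)
  ... | inj₂ (inj₁ Bx) = ⊥-elim (not-¬ Bx ¬Bx)
  ... | inj₂ (inj₂ Rx) = Rx

  A-by-edge : ∀ {c z} → C c ≡ true → E c z ≡ true → R z ≡ true → A c ≡ true
  A-by-edge Cc cz Rz = ∧-true⁺ Cc (touchesR⁺ cz Rz)

  B≁R : ∀ {b z} → B b ≡ true → R z ≡ true → E b z ≡ false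
  B≁R {b} {z} Bb Rz = ¬-not (λ bz → A≢B (A-by-edge (B⇒C Bb) bz Rz) Bb refl)

  ω≤deg : ∀ {a} → A a ≡ true → ω ≤ deg a
  ω≤deg {a} Aa with touchesR⁻ a (proj₂ (∧-true⁻ Aa))
  ... | z , az∧Rz with ∧-true⁻ {E a z} az∧Rz
  ... | az , Rz = begin
    ω                                                            ≡⟨ trans (sym |C|≡ω) (count-remove C (A⇒C Aa)) ⟩
    suc (count (C ∖ a))                                          ≡⟨ +-comm 1 (count (C ∖ a)) ⟩
    count (C ∖ a) + 1                                            ≤⟨ +-mono-≤ (count-mono in-C) (subst (_≤ _) (count-≟ z) (count-mono at-z)) ⟩
    count (λ v → E a v ∧ C v) + count (λ v → E a v ∧ not (C v))  ≡⟨ count-split (E a) C ⟨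
    deg a                                                        ∎
    where
    open ≤-Reasoning
    in-C : ∀ v → (C ∖ a) v ≡ true → E a v ∧ C v ≡ true
    in-C v C∖a = let Cv , a≢v = ∖⁻ C a C∖a in ∧-true⁺ (C-clique a v (A⇒C Aa) Cv a≢v) Cv
    at-z : ∀ v → does (z ≟ v) ≡ true → E a v ∧ not (C v) ≡ true
    at-z v z≟v with ≟-true⁻ {x = z} {v} z≟v
    ... | refl = ∧-true⁺ {E a v} az Rz

  K : V → V → Bool
  K u v = E u v ∨ (A u ∧ R v ∨ R u ∧ A v)

  K-sym : ∀ u v → K u v ≡ K v u
  K-sym u v = cong₂ _∨_ (E-sym u v) (trans (∨-comm (A u ∧ R v) (R u ∧ A v)) (cong₂ _∨_ (∧-comm (R u) (A v)) (∧-comm (A u) (R v))))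

  K-irrefl : ∀ v → K v v ≡ false
  K-irrefl v rewrite irrefl G v with C v | touchesR v
  ... | true  | true  = refl
  ... | true  | false = refl
  ... | false | _     = refl

  E⇒K : ∀ u v → E u v ≡ true → K u v ≡ true
  E⇒K u v uv rewrite uv = refl

  AR⇒K : ∀ {u v} → A u ≡ true → R v ≡ true → K u v ≡ true
  AR⇒K {u} {v} Au Rv rewrite Au | Rv = ∨-zeroʳ (E u v)

  RA⇒K : ∀ {u v} → R u ≡ true → A v ≡ true → K u v ≡ true
  RA⇒K {u} {v} Ru Av = trans (K-sym u v) (AR⇒K Av Ru)

  K-cases : ∀ u v → K u v ≡ true → E u v ≡ true ⊎ (A u ≡ true × R v ≡ true) ⊎ (R u ≡ true × A v ≡ true)
  K-cases u v uv with E u v | A u ∧ R v in AuRv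
  ... | true  | _    = inj₁ refl
  ... | false | true = inj₂ (inj₁ (∧-true⁻ AuRv))
  ... | false | false = inj₂ (inj₂ (∧-true⁻ uv))

  closure-condition : ∀ u v → K u v ≡ true → E u v ≡ false → n ≤ deg u + deg v
  closure-condition u v uv u≁v with K-cases u v uv
  ... | inj₁ uv′               = ⊥-elim (not-¬ uv′ u≁v)
  ... | inj₂ (inj₁ (Au , Rv)) = ≤-trans n≤δ+ω (subst (_≤ deg u + deg v) (+-comm ω δ) (+-mono-≤ (ω≤deg Au) (δ≤deg v)))
  ... | inj₂ (inj₂ (Ru , Av)) = ≤-trans n≤δ+ω (+-mono-≤ (δ≤deg u) (ω≤deg Av))

  hamiltonian-via-K : CycleThrough K (λ _ → true) → Hamiltonian G
  hamiltonian-via-K = hamiltonian G 3≤n ∘ Closure.closure-lemma E E-sym (irrefl G) K K-sym E⇒K closure-condition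

  no-R-case : (∀ z → R z ≡ false) → Hamiltonian G
  no-R-case no-R = complete⇒hamiltonian G 3≤n (λ u v → C-clique u v (not-injective (no-R u)) (not-injective (no-R v)))

  no-B-case : (∀ z → B z ≡ false) → Hamiltonian G
  no-B-case no-B = hamiltonian-via-K (Ore.ore K K-sym K-irrefl (λ _ → true) (2≤count-all 3≤n) ore-condition)
    where
    R-sees-C : ∀ {u} → R u ≡ true → ω ≤ count (K u)
    R-sees-C {u} Ru = subst (_≤ count (K u)) |C|≡ω (count-mono K-to-C)
      where
      K-to-C : ∀ c → C c ≡ true → K u c ≡ true
      K-to-C c Cc with C⇒A⊎B Cc
      ... | inj₁ Ac = RA⇒K Ru Ac
      ... | inj₂ Bc = ⊥-elim (not-¬ Bc (no-B c))
    ore-condition : Ore.OreCondition K K-sym K-irrefl (λ _ → true)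
    ore-condition u v _ _ u≢v u≁v with vertex-cases u | vertex-cases v
    ... | inj₂ (inj₁ Bu) | _              = ⊥-elim (not-¬ Bu (no-B u))
    ... | _              | inj₂ (inj₁ Bv) = ⊥-elim (not-¬ Bv (no-B v))
    ... | inj₁ Au        | inj₁ Av        = ⊥-elim (not-¬ (E⇒K u v (C-clique u v (A⇒C Au) (A⇒C Av) u≢v)) u≁v)
    ... | inj₁ Au        | inj₂ (inj₂ Rv) = ⊥-elim (not-¬ (AR⇒K Au Rv) u≁v)
    ... | inj₂ (inj₂ Ru) | inj₁ Av        = ⊥-elim (not-¬ (RA⇒K Ru Av) u≁v)
    ... | inj₂ (inj₂ Ru) | inj₂ (inj₂ Rv) = begin
      count {n} (λ _ → true)  ≡⟨ count-all ⟩
      n                      ≤⟨ n≤δ+ω ⟩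
      δ + ω                  ≤⟨ +-mono-≤ (≤-trans (δ≤deg u) (count-mono (E⇒K u))) (R-sees-C Rv) ⟩
      count (K u) + count (K v) ∎
      where open ≤-Reasoning

  walk-meets-A : ∀ {ok s t} → Walk G ok s t → C s ≡ true → R t ≡ true → ∃ λ a → ok a × A a ≡ true
  walk-meets-A (here _) Cs Rt = ⊥-elim (C≢R Cs Rt refl)
  walk-meets-A (step {w = w} ok-s sw walk) Cs Rt with C w in Cw
  ... | true  = walk-meets-A walk Cw Rt
  ... | false = _ , ok-s , A-by-edge Cs sw (¬C⇒R Cw)

  R-edge-or-none : (∃₂ λ u₁ u₂ → R u₁ ≡ true × R u₂ ≡ true × E u₁ u₂ ≡ true) ⊎
                   (∀ u v → R u ≡ true → R v ≡ true → E u v ≡ false)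
  R-edge-or-none with search (λ u → (R u ≟ᵇ true) ×-dec any? (λ v → (R v ≟ᵇ true) ×-dec (E u v ≟ᵇ true)))
  ... | inj₁ (u , Ru , v , Rv , uv) = inj₁ (u , v , Ru , Rv , uv)
  ... | inj₂ none                   = inj₂ (λ u v Ru Rv → ¬-not (λ uv → none u (Ru , v , Rv , uv)))

  module BAndR (b₀ : V) (Bb₀ : B b₀ ≡ true) (u₀ : V) (Ru₀ : R u₀ ≡ true) where

    a₀-exists : ∃ λ a → ⊤ × A a ≡ true
    a₀-exists = walk-meets-A (proj₁ (proj₂ two-connected) b₀ u₀ tt tt) (B⇒C Bb₀) Ru₀

    a₀ : V
    a₀ = proj₁ a₀-exists

    Aa₀ : A a₀ ≡ true
    Aa₀ = proj₂ (proj₂ a₀-exists)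

    a₁-exists : ∃ λ a → a ≢ a₀ × A a ≡ true
    a₁-exists = walk-meets-A (proj₂ (proj₂ two-connected) a₀ b₀ u₀ (A≢B Aa₀ Bb₀ ∘ sym) (C≢R (A⇒C Aa₀) Ru₀ ∘ sym))
                             (B⇒C Bb₀) Ru₀

    a₁ : V
    a₁ = proj₁ a₁-exists

    a₁≢a₀ : a₁ ≢ a₀
    a₁≢a₀ = proj₁ (proj₂ a₁-exists)

    Aa₁ : A a₁ ≡ true
    Aa₁ = proj₂ (proj₂ a₁-exists)

    -- B is spliced back in as a path a₁ … a₀ through the clique, so a₀ is left out as well.
    W : V → Bool
    W = (not ∘ B) ∖ a₀

    W-A : ∀ {z} → A z ≡ true → z ≢ a₀ → W z ≡ true
    W-A Az z≢a₀ = ∖⁺ (not ∘ B) a₀ (cong not (A⇒¬B Az)) (z≢a₀ ∘ sym)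

    W-R : ∀ {z} → R z ≡ true → W z ≡ true
    W-R Rz = ∖⁺ (not ∘ B) a₀ (cong not (R⇒¬B Rz)) (C≢R (A⇒C Aa₀) Rz)

    W⇒A⊎R : ∀ {z} → W z ≡ true → A z ≡ true ⊎ R z ≡ true
    W⇒A⊎R Wz = ¬B⇒A⊎R (not-injective (proj₁ (∖⁻ (not ∘ B) a₀ Wz)))

    W⇒≢a₀ : ∀ {z} → W z ≡ true → z ≢ a₀
    W⇒≢a₀ Wz = proj₂ (∖⁻ (not ∘ B) a₀ Wz) ∘ sym

    W⇒¬B : ∀ {z} → W z ≡ true → B z ≡ false
    W⇒¬B Wz = not-injective (proj₁ (∖⁻ (not ∘ B) a₀ Wz))

    suc|W|≡α+r : suc (count W) ≡ α + r
    suc|W|≡α+r = +-cancelˡ-≡ β _ _ (begin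
      β + suc (count W)     ≡⟨ cong (β +_) (count-remove (not ∘ B) (cong not (A⇒¬B Aa₀))) ⟨
      β + count (not ∘ B)   ≡⟨ trans (sym count-all) (count-split (λ _ → true) B) ⟨
      n                     ≡⟨ ω+r≡n ⟨
      ω + r                 ≡⟨ cong (_+ r) (trans (sym α+β≡ω) (+-comm α β)) ⟩
      β + α + r             ≡⟨ +-assoc β α r ⟩
      β + (α + r)           ∎)
      where open ≡-Reasoning

    a₀-sees-W : ∀ {z} → W z ≡ true → K a₀ z ≡ true
    a₀-sees-W {z} Wz with W⇒A⊎R Wz
    ... | inj₁ Az = E⇒K a₀ z (C-clique a₀ z (A⇒C Aa₀) (A⇒C Az) (W⇒≢a₀ Wz ∘ sym))
    ... | inj₂ Rz = AR⇒K Aa₀ Rz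

    B-path : ∃₂ λ b b′ → ∃ λ Bs → Path K b b′ Bs × Unique Bs × (∀ z → B z ≡ true → z ∈ Bs) × (∀ z → z ∈ Bs → B z ≡ true)
    B-path with listing B
    ... | []     , _ , B⊆ , _  with B⊆ b₀ Bb₀
    ...   | ()
    B-path | b ∷ bs , u , B⊆ , ⊆B with clique-path u (λ x y x∈ y∈ → E⇒K x y ∘ C-clique x y (B⇒C (⊆B x x∈)) (B⇒C (⊆B y y∈)))
    ... | b′ , p = b , b′ , b ∷ bs , p , u , B⊆ , ⊆B

    splice-B : ∀ {w y t} → Path K w y t → K y a₁ ≡ true → Unique (a₁ ∷ t) →
               (∀ z → z ∈ t → W z ≡ true) → (∀ z → W z ≡ true → z ∈ a₁ ∷ t) → Hamiltonian G
    splice-B {w} {y} {t} q ya₁ unique-a₁t t⊆W W⊆a₁t with B-path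
    ... | b , b′ , Bs , pB , uB , B⊆ , ⊆B =
      hamiltonian-via-K (cycle-through (a₁ ∷ Bs ++ a₀ ∷ t) (cycle spliced ya₁) unique′ (λ z _ → covered z) (λ _ _ → refl))
      where
      spliced : Path K a₁ y (a₁ ∷ Bs ++ a₀ ∷ t)
      spliced = hop (E⇒K a₁ b (C-clique a₁ b (A⇒C Aa₁) (B⇒C (⊆B b (first∈ pB))) (A≢B Aa₁ (⊆B b (first∈ pB)))))
                    (Path-++ pB (E⇒K b′ a₀ (C-clique b′ a₀ (B⇒C (⊆B b′ (last∈ pB))) (A⇒C Aa₀) (A≢B Aa₀ (⊆B b′ (last∈ pB)) ∘ sym)))
                       (hop (a₀-sees-W (t⊆W w (first∈ q))) q))
      a₀∉t : a₀ ∉ t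
      a₀∉t a₀∈t = W⇒≢a₀ (t⊆W a₀ a₀∈t) refl
      Bs∩a₀t : Disjoint Bs (a₀ ∷ t)
      Bs∩a₀t (z∈Bs , here refl)  = not-¬ (⊆B _ z∈Bs) (A⇒¬B Aa₀)
      Bs∩a₀t (z∈Bs , there z∈t) = not-¬ (⊆B _ z∈Bs) (W⇒¬B (t⊆W _ z∈t))
      a₁∉ : a₁ ∉ Bs ++ a₀ ∷ t
      a₁∉ a₁∈ with ∈-++⁻ Bs a₁∈
      ... | inj₁ a₁∈Bs         = not-¬ (⊆B _ a₁∈Bs) (A⇒¬B Aa₁)
      ... | inj₂ (here a₁≡a₀)  = a₁≢a₀ a₁≡a₀
      ... | inj₂ (there a₁∈t) = Unique[x∷xs]⇒x∉xs unique-a₁t a₁∈t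
      unique′ : Unique (a₁ ∷ Bs ++ a₀ ∷ t)
      unique′ = ¬Any⇒All¬ _ a₁∉ ∷ ++⁺ uB (¬Any⇒All¬ t a₀∉t ∷ AllPairs.tail unique-a₁t) Bs∩a₀t
      covered : ∀ z → z ∈ a₁ ∷ Bs ++ a₀ ∷ t
      covered z with B z in Bz | z ≟ a₀
      ... | true  | _         = there (∈-++⁺ˡ (B⊆ z Bz))
      ... | false | yes refl  = there (∈-++⁺ʳ Bs (here refl))
      ... | false | no z≢a₀ with W⊆a₁t z (∖⁺ (not ∘ B) a₀ (cong not Bz) (z≢a₀ ∘ sym))
      ...   | here z≡a₁  = here z≡a₁
      ...   | there z∈t = there (∈-++⁺ʳ Bs (there z∈t))

    insert-B : CycleThrough K W → Hamiltonian G
    insert-B (cycle-through L C₀ uL covers inside) with Cycle-open K-irrefl C₀ (covers a₁ (W-A Aa₁ a₁≢a₀))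
    ... | _ , _ , t , _ , q , ya₁ , L↭a₁t =
      splice-B q ya₁ (Unique-resp-↭ L↭a₁t uL) (λ z z∈t → inside z (∈-resp-↭ (↭-sym L↭a₁t) (there z∈t)))
                     (λ z → ∈-resp-↭ L↭a₁t ∘ covers z)

    α≤1+count : (Q : V → Bool) → (∀ a → A a ≡ true → a ≢ a₀ → Q a ≡ true) → α ≤ suc (count Q)
    α≤1+count Q A∖a₀⊆Q = begin
      α                    ≡⟨ count-remove A Aa₀ ⟩
      suc (count (A ∖ a₀)) ≤⟨ s≤s (count-mono (λ a A∖a₀ → let Aa , a₀≢a = ∖⁻ A a₀ A∖a₀ in A∖a₀⊆Q a Aa (a₀≢a ∘ sym))) ⟩
      suc (count Q)        ∎
      where open ≤-Reasoning

    open Ore K K-sym K-irrefl W using () renaming (degIn to degW)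

    δ≤1+degW : ∀ {u} → R u ≡ true → δ ≤ suc (degW u)
    δ≤1+degW {u} Ru = begin
      δ                                                        ≤⟨ δ≤deg u ⟩
      deg u                                                    ≡⟨ count-split (E u) (λ v → does (a₀ ≟ v)) ⟩
      count (λ v → E u v ∧ does (a₀ ≟ v)) + count (E u ∖ a₀)  ≤⟨ +-mono-≤ at-most-a₀ (count-mono neighbour) ⟩
      suc (degW u)                                             ∎
      where
      open ≤-Reasoning
      at-most-a₀ : count (λ v → E u v ∧ does (a₀ ≟ v)) ≤ 1
      at-most-a₀ = subst (count (λ v → E u v ∧ does (a₀ ≟ v)) ≤_) (count-≟ a₀) (count-mono (λ v → proj₂ ∘ ∧-true⁻ {E u v}))
      neighbour : ∀ v → (E u ∖ a₀) v ≡ true → W v ∧ K u v ≡ true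
      neighbour v E∖a₀ = let uv , a₀≢v = ∖⁻ (E u) a₀ E∖a₀ in
        ∧-true⁺ (∖⁺ (not ∘ B) a₀ (cong not (¬-not (λ Bv → not-¬ (trans (E-sym v u) uv) (B≁R Bv Ru)))) a₀≢v) (E⇒K u v uv)

    non-edge-in-W⇒R : ∀ {u v} → W u ≡ true → W v ≡ true → u ≢ v → K u v ≡ false → R u ≡ true × R v ≡ true
    non-edge-in-W⇒R {u} {v} Wu Wv u≢v u≁v with W⇒A⊎R Wu | W⇒A⊎R Wv
    ... | inj₁ Au | inj₁ Av = ⊥-elim (not-¬ (E⇒K u v (C-clique u v (A⇒C Au) (A⇒C Av) u≢v)) u≁v)
    ... | inj₁ Au | inj₂ Rv = ⊥-elim (not-¬ (AR⇒K Au Rv) u≁v)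
    ... | inj₂ Ru | inj₁ Av = ⊥-elim (not-¬ (RA⇒K Ru Av) u≁v)
    ... | inj₂ Ru | inj₂ Rv = Ru , Rv

    two≤|W| : 2 ≤ count W
    two≤|W| = length≤count W {a₁ ∷ u₀ ∷ []} ((C≢R (A⇒C Aa₁) Ru₀ All.∷ All.[]) ∷ (All.[] ∷ AllPairs.[])) in-W
      where
      in-W : ∀ z → z ∈ a₁ ∷ u₀ ∷ [] → W z ≡ true
      in-W z (here refl)         = W-A Aa₁ a₁≢a₀
      in-W z (there (here refl)) = W-R Ru₀

    unbalanced-case : α ≢ r → Hamiltonian G
    unbalanced-case α≢r = insert-B (Ore.ore K K-sym K-irrefl W two≤|W| ore-condition)
      where
      α≤1+degW : ∀ {u} → R u ≡ true → α ≤ suc (degW u)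
      α≤1+degW Ru = α≤1+count _ (λ a Aa a≢a₀ → ∧-true⁺ (W-A Aa a≢a₀) (RA⇒K Ru Aa))
      ore-condition : Ore.OreCondition K K-sym K-irrefl W
      ore-condition u v Wu Wv u≢v u≁v with non-edge-in-W⇒R Wu Wv u≢v u≁v
      ... | Ru , Rv = ≤-pred (subst (_≤ suc (degW u + degW v)) (sym suc|W|≡α+r)
                        (degree-sum-bound α≢r r≤δ (α≤1+degW Ru) (α≤1+degW Rv) (δ≤1+degW Ru) (δ≤1+degW Rv)))

    module WithREdge (α≡r : α ≡ r) (u₁ u₂ : V) (Ru₁ : R u₁ ≡ true) (Ru₂ : R u₂ ≡ true) (u₁u₂ : E u₁ u₂ ≡ true) where

      -- Without edges inside R the cycle neighbours of u₁ lie in A, so u₂ can be put after u₁.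
      K′ : V → V → Bool
      K′ u v = K u v ∧ not (R u ∧ R v)

      K′-sym : ∀ u v → K′ u v ≡ K′ v u
      K′-sym u v = cong₂ (λ k s → k ∧ not s) (K-sym u v) (∧-comm (R u) (R v))

      K′-irrefl : ∀ v → K′ v v ≡ false
      K′-irrefl v rewrite K-irrefl v = refl

      K′⇒K : ∀ u v → K′ u v ≡ true → K u v ≡ true
      K′⇒K u v = proj₁ ∘ ∧-true⁻

      K⇒K′ : ∀ {u v} → K u v ≡ true → R v ≡ false → K′ u v ≡ true
      K⇒K′ {u} uv ¬Rv rewrite ¬Rv | ∧-zeroʳ (R u) = ∧-true⁺ uv refl

      K′-non-edge : ∀ {u v} → K u v ∧ not (R u ∧ R v) ≡ false → K u v ≡ false ⊎ (R u ≡ true × R v ≡ true)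
      K′-non-edge {u} {v} u≁′v with K u v | R u ∧ R v in RuRv
      ... | false | _     = inj₁ refl
      ... | true  | true  = inj₂ (∧-true⁻ RuRv)

      W′ : V → Bool
      W′ = W ∖ u₂

      u₁≢u₂ : u₁ ≢ u₂
      u₁≢u₂ refl = not-¬ u₁u₂ (irrefl G u₁)

      W′-A : ∀ {a} → A a ≡ true → a ≢ a₀ → W′ a ≡ true
      W′-A Aa a≢a₀ = ∖⁺ W u₂ (W-A Aa a≢a₀) (C≢R (A⇒C Aa) Ru₂ ∘ sym)

      open Ore K′ K′-sym K′-irrefl W′ using () renaming (degIn to degW′)

      α≤1+degW′ : ∀ {u} → R u ≡ true → α ≤ suc (degW′ u)
      α≤1+degW′ {u} Ru = α≤1+count _ (λ a Aa a≢a₀ → ∧-true⁺ (W′-A Aa a≢a₀) (K⇒K′ (RA⇒K Ru Aa) (R-of-A Aa)))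
        where
        R-of-A : ∀ {a} → A a ≡ true → R a ≡ false
        R-of-A Aa = cong not (A⇒C Aa)

      two≤|W′| : 2 ≤ count W′
      two≤|W′| = length≤count W′ {a₁ ∷ u₁ ∷ []} ((C≢R (A⇒C Aa₁) Ru₁ All.∷ All.[]) ∷ (All.[] ∷ AllPairs.[])) in-W′
        where
        in-W′ : ∀ z → z ∈ a₁ ∷ u₁ ∷ [] → W′ z ≡ true
        in-W′ z (here refl)         = W′-A Aa₁ a₁≢a₀
        in-W′ z (there (here refl)) = ∖⁺ W u₂ (W-R Ru₁) (u₁≢u₂ ∘ sym)

      ore-condition : Ore.OreCondition K′ K′-sym K′-irrefl W′
      ore-condition u v W′u W′v u≢v u≁′v = ≤-pred (≤-pred (begin
        suc (suc (count W′))  ≡⟨ cong suc (count-remove W (W-R Ru₂)) ⟨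
        suc (count W)         ≡⟨ suc|W|≡α+r ⟩
        α + r                 ≡⟨ cong (α +_) α≡r ⟨
        α + α                 ≤⟨ +-mono-≤ (α≤1+degW′ Ru) (α≤1+degW′ Rv) ⟩
        suc (degW′ u) + suc (degW′ v) ≡⟨ cong suc (+-suc (degW′ u) (degW′ v)) ⟩
        suc (suc (degW′ u + degW′ v)) ∎))
        where
        open ≤-Reasoning
        Wu = proj₁ (∖⁻ W u₂ W′u)
        Wv = proj₁ (∖⁻ W u₂ W′v)
        both-R : R u ≡ true × R v ≡ true
        both-R with K′-non-edge u≁′v
        ... | inj₁ u≁v  = non-edge-in-W⇒R Wu Wv u≢v u≁v
        ... | inj₂ RuRv = RuRv
        Ru = proj₁ both-R
        Rv = proj₂ both-R

      reinsert-u₂ : CycleThrough K′ W′ → CycleThrough K W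
      reinsert-u₂ (cycle-through L C₀ uL coversW′ insideW′) with Cycle-open K′-irrefl C₀ (coversW′ u₁ (∖⁺ W u₂ (W-R Ru₁) (u₁≢u₂ ∘ sym)))
      ... | w , y , t , u₁w , q , yu₁ , L↭u₁t =
        cycle-through (u₁ ∷ u₂ ∷ t) (cycle extended (K′⇒K y u₁ yu₁)) unique′ covered inside′
        where
        t⊆W′ : ∀ {z} → z ∈ t → W′ z ≡ true
        t⊆W′ z∈t = insideW′ _ (∈-resp-↭ (↭-sym L↭u₁t) (there z∈t))
        unique-u₁t : Unique (u₁ ∷ t)
        unique-u₁t = Unique-resp-↭ L↭u₁t uL
        Aw : A w ≡ true
        Aw with W⇒A⊎R (proj₁ (∖⁻ W u₂ (t⊆W′ (first∈ q))))
        ... | inj₁ Aw = Aw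
        ... | inj₂ Rw = ⊥-elim (not-¬ u₁w (trans (cong (λ s → K u₁ w ∧ not s) (∧-true⁺ Ru₁ Rw)) (∧-zeroʳ (K u₁ w))))
        extended : Path K u₁ y (u₁ ∷ u₂ ∷ t)
        extended = hop (E⇒K u₁ u₂ u₁u₂) (hop (RA⇒K Ru₂ Aw) (Path-map K′⇒K q))
        u₂∉t : u₂ ∉ t
        u₂∉t u₂∈t = proj₂ (∖⁻ W u₂ (t⊆W′ u₂∈t)) refl
        u₁∉ : u₁ ∉ u₂ ∷ t
        u₁∉ (here u₁≡u₂) = u₁≢u₂ u₁≡u₂
        u₁∉ (there u₁∈t) = Unique[x∷xs]⇒x∉xs unique-u₁t u₁∈t
        unique′ : Unique (u₁ ∷ u₂ ∷ t)
        unique′ = ¬Any⇒All¬ _ u₁∉ ∷ ¬Any⇒All¬ t u₂∉t ∷ AllPairs.tail unique-u₁t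
        covered : ∀ z → W z ≡ true → z ∈ u₁ ∷ u₂ ∷ t
        covered z Wz with u₂ ≟ z
        ... | yes refl = there (here refl)
        ... | no u₂≢z with ∈-resp-↭ L↭u₁t (coversW′ z (∖⁺ W u₂ Wz u₂≢z))
        ...   | here z≡u₁  = here z≡u₁
        ...   | there z∈t = there (there z∈t)
        inside′ : ∀ z → z ∈ u₁ ∷ u₂ ∷ t → W z ≡ true
        inside′ z (here refl)          = W-R Ru₁
        inside′ z (there (here refl))  = W-R Ru₂
        inside′ z (there (there z∈t)) = proj₁ (∖⁻ W u₂ (t⊆W′ z∈t))

      balanced-case-with-R-edge : Hamiltonian G
      balanced-case-with-R-edge = insert-B (reinsert-u₂ (Ore.ore K′ K′-sym K′-irrefl W′ two≤|W′| ore-condition))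

    module WithoutREdge (α≡r : α ≡ r) (no-R-edge : ∀ u v → R u ≡ true → R v ≡ true → E u v ≡ false) where

      R-sees-A : ∀ {u a} → R u ≡ true → A a ≡ true → E u a ≡ true
      R-sees-A {u} {a} Ru Aa with E u a in ua
      ... | true  = refl
      ... | false = ⊥-elim (<-irrefl refl (begin-strict
        δ                    ≤⟨ δ≤deg u ⟩
        deg u                ≤⟨ count-mono neighbour ⟩
        count (A ∖ a)        <⟨ ≤-reflexive (sym (count-remove A Aa)) ⟩
        α                    ≡⟨ α≡r ⟩
        r                    ≤⟨ r≤δ ⟩
        δ                    ∎))
        where
        open ≤-Reasoning
        neighbour : ∀ z → E u z ≡ true → (A ∖ a) z ≡ true
        neighbour z uz with vertex-cases z
        ... | inj₁ Az        = ∖⁺ A a Az (λ { refl → not-¬ uz ua })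
        ... | inj₂ (inj₁ Bz) = ⊥-elim (not-¬ (trans (E-sym z u) uz) (B≁R Bz Ru))
        ... | inj₂ (inj₂ Rz) = ⊥-elim (not-¬ uz (no-R-edge u z Ru Rz))

      n∸ω≡r : n ∸ ω ≡ r
      n∸ω≡r = trans (cong (_∸ ω) (sym ω+r≡n)) (m+n∸m≡n ω r)

      2ω≡n+β : 2 * ω ≡ n + β
      2ω≡n+β = begin
        2 * ω          ≡⟨ cong (ω +_) (+-identityʳ ω) ⟩
        ω + ω          ≡⟨ cong (ω +_) (sym α+β≡ω) ⟩
        ω + (α + β)    ≡⟨ cong (λ a → ω + (a + β)) α≡r ⟩
        ω + (r + β)    ≡⟨ +-assoc ω r β ⟨
        ω + r + β      ≡⟨ cong (_+ β) ω+r≡n ⟩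
        n + β          ∎
        where open ≡-Reasoning

      2ω∸n≡β : 2 * ω ∸ n ≡ β
      2ω∸n≡β = trans (cong (_∸ n) 2ω≡n+β) (m+n∸m≡n n β)

      1≤β : 1 ≤ β
      1≤β = subst (1 ≤_) (sym (count-remove B Bb₀)) (s≤s z≤n)

      2≤α : 2 ≤ α
      2≤α = length≤count A {a₁ ∷ a₀ ∷ []} ((a₁≢a₀ All.∷ All.[]) ∷ (All.[] ∷ AllPairs.[])) in-A
        where
        in-A : ∀ z → z ∈ a₁ ∷ a₀ ∷ [] → A z ≡ true
        in-A z (here refl)         = Aa₁
        in-A z (there (here refl)) = Aa₀

      k₁ k₂ : ℕ
      k₁ = n ∸ ω
      k₂ = 2 * ω ∸ n

      H : Graph (k₂ + k₁)
      H = complete k₂ ∪ᴳ edgeless k₁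

      enum-A : Enumeration A k₁
      enum-A = subst (Enumeration A) (trans α≡r (sym n∸ω≡r)) (enumerate A)

      enum-B : Enumeration B k₂
      enum-B = subst (Enumeration B) (sym 2ω∸n≡β) (enumerate B)

      enum-R : Enumeration R k₁
      enum-R = subst (Enumeration R) (sym n∸ω≡r) (enumerate R)

      open ThreeBlocks enum-A enum-B enum-R (λ _ → A⇒¬B) (λ _ → cong not ∘ A⇒C) (λ _ → cong not ∘ B⇒C) (λ _ → ¬A¬B⇒R)


      H-join : ∀ x y → adj H (join k₂ k₁ x) (join k₂ k₁ y) ≡ sumAdj false (complete k₂) (edgeless k₁) x y
      H-join = sumGraph-join false (complete k₂) (edgeless k₁)

      block-adjacency : ∀ u v → adj G u v ≡ sumAdj true (complete k₁) H (map₂ (join k₂ k₁) (proj₁ (classify u)))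
                                                                         (map₂ (join k₂ k₁) (proj₁ (classify v)))
      block-adjacency u v with classify u | classify v
      ... | _ , in₁ p | _ , in₁ q = clique-adj G enum-A (λ u v Au Av → C-clique u v (A⇒C Au) (A⇒C Av)) u v p q
      ... | _ , in₁ p | _ , in₂ q = C-clique u v (A⇒C p) (B⇒C q) (A≢B p q)
      ... | _ , in₁ p | _ , in₃ q = trans (E-sym u v) (R-sees-A q p)
      ... | _ , in₂ p | _ , in₁ q = C-clique u v (B⇒C p) (A⇒C q) (A≢B q p ∘ sym)
      ... | _ , in₂ p | _ , in₂ q =
        trans (clique-adj G enum-B (λ u v Bu Bv → C-clique u v (B⇒C Bu) (B⇒C Bv)) u v p q) (sym (H-join (inj₁ _) (inj₁ _)))
      ... | _ , in₂ p | _ , in₃ q = trans (B≁R p q) (sym (H-join (inj₁ _) (inj₂ _)))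
      ... | _ , in₃ p | _ , in₁ q = R-sees-A p q
      ... | _ , in₃ p | _ , in₂ q = trans (trans (E-sym u v) (B≁R q p)) (sym (H-join (inj₂ _) (inj₁ _)))
      ... | _ , in₃ p | _ , in₃ q = trans (no-R-edge u v p q) (sym (H-join (inj₂ _) (inj₂ _)))

      G≅exceptional : G ≅ exceptional n ω
      G≅exceptional = iso , λ u v → trans (block-adjacency u v) (sym (sumGraph-join true (complete k₁) H (blocks u) (blocks v)))
        where
        blocks : V → Fin k₁ ⊎ Fin (k₂ + k₁)
        blocks x = map₂ (join k₂ k₁) (proj₁ (classify x))

      exceptional-case : (n + 1 ≤ 2 * ω) × (ω + 2 ≤ n) × (G ≅ exceptional n ω)
      exceptional-case = subst (n + 1 ≤_) (sym 2ω≡n+β) (+-monoʳ-≤ n 1≤β) ,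
                         subst (ω + 2 ≤_) ω+r≡n (+-monoʳ-≤ ω (subst (2 ≤_) α≡r 2≤α)) ,
                         G≅exceptional

corollary1p3 : (n : ℕ) (G : Graph n) (δ ω : ℕ) → TwoConnected G → IsMinDegree G δ → IsCliqueNumber G ω
    → n ≤ δ + ω
    → Hamiltonian G ⊎ ((n + 1 ≤ 2 * ω) × (ω + 2 ≤ n) × (G ≅ exceptional n ω))
corollary1p3 n G δ ω two-connected min-degree clique-number n≤δ+ω = by-cases
  where
  open CliquePartition G δ ω two-connected min-degree clique-number n≤δ+ω
  by-cases : Hamiltonian G ⊎ ((n + 1 ≤ 2 * ω) × (ω + 2 ≤ n) × (G ≅ exceptional n ω))
  by-cases with find B | find R
  ... | inj₂ no-B       | _               = inj₁ (no-B-case no-B)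
  ... | inj₁ _          | inj₂ no-R       = inj₁ (no-R-case no-R)
  ... | inj₁ (b₀ , Bb₀) | inj₁ (u₀ , Ru₀) with α ≟ℕ r | R-edge-or-none
  ...   | no α≢r  | _                                  = inj₁ (BAndR.unbalanced-case b₀ Bb₀ u₀ Ru₀ α≢r)
  ...   | yes α≡r | inj₁ (u₁ , u₂ , Ru₁ , Ru₂ , u₁u₂) =
    inj₁ (BAndR.WithREdge.balanced-case-with-R-edge b₀ Bb₀ u₀ Ru₀ α≡r u₁ u₂ Ru₁ Ru₂ u₁u₂)
  ...   | yes α≡r | inj₂ no-R-edge                     = inj₂ (BAndR.WithoutREdge.exceptional-case b₀ Bb₀ u₀ Ru₀ α≡r no-R-edge)
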